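{- Let $2\le k\le n-2$, let $v_1,\dots,v_{\binom nk}$ be the vertices of $\Delta(k,n)$ in descending lexicographic order, and let $\kappa=\kappa_{k,n}$ be the lifting function with $\kappa(v_i)=1$ for $1\le i\le\binom{n-1}{k-1}-1$ and $\kappa(v_i)=0$ otherwise. Let $\tilde\Delta(k,n)=\operatorname{conv}\{(v_i,\kappa(v_i))\}\subset\mathbb{R}^{n+1}$. For $i\in\{n-k+2,\dots,n\}$ consider the affine function $g_i(x)=-x_1+x_i+x_{n+1}$ on $\mathbb{R}^{n+1}$. Then (1) each $g_i$ cuts out a lower facet of $\tilde\Delta(k,n)$ (i.e., $g_i\ge0$ on $\tilde\Delta(k,n)$ and the set where $g_i=0$ is a lower facet); (2) these facets are (lattice) isomorphic to pyramids of lattice height one over $\Delta(k,n-1)$. There are exactly $k-1$ such facets.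
   Context: The hypersimplex $\Delta(k,n)=\operatorname{conv}\{e_X : X\subseteq[n],\ |X|=k\}\subset\mathbb{R}^n$ with $e_X=\sum_{i\in X}e_i$; vertices are ordered in descending lexicographic order as 0/1-vectors (e.g., for $\Delta(2,4)$: $1100,1010,1001,0110,0101,0011$). A lower face of the lifted polytope is a face admitting an outer normal vector with negative last coordinate. A pyramid of lattice height one over a lattice polytope $Q$ is the convex hull of (a lattice-isomorphic copy of) $Q$ and an apex lying at lattice distance one from the affine hull of $Q$. -}

module Defs where

open import Data.Nat using (ℕ; zero; suc; _∸_; _<_; _<?_)
open import Data.Nat.Combinatorics using (_C_)
open import Data.Integer using (ℤ; +_; -_; _+_; _*_; _≟_)
open import Data.Bool using (Bool; true; false)
open import Data.List using (List; []; _∷_; _++_; map; length; filter)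
open import Data.List.Relation.Unary.All using (All)
open import Data.List.Membership.Propositional using (_∈_)
open import Data.Vec using (Vec; []; _∷_; _∷ʳ_; replicate)
open import Data.Product using (Σ; _×_; ∃; _,_)
open import Relation.Nullary using (¬_; yes; no)
open import Relation.Binary.PropositionalEquality using (_≡_)

-- Points are integer vectors; coordinate x_j (1-based) is index j-1.

Pt : ℕ → Set
Pt m = Vec ℤ m

-- coordinate with 0-based index (0 outside the range)
nth : ∀ {m} → Pt m → ℕ → ℤ
nth []       _       = + 0
nth (x ∷ xs) zero    = x
nth (x ∷ xs) (suc j) = nth xs j

-- Vertices of the hypersimplex Δ(k,n): 0/1-vectors of length n with
-- exactly k ones, in descending lexicographic order.

combos : (n k : ℕ) → List (Vec Bool n)
combos zero    zero    = [] ∷ []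
combos zero    (suc k) = []
combos (suc n) zero    = replicate (suc n) false ∷ []
combos (suc n) (suc k) = map (true ∷_) (combos n k) ++ map (false ∷_) (combos n (suc k))

b2z : Bool → ℤ
b2z true  = + 1
b2z false = + 0

toℤ : ∀ {n} → Vec Bool n → Pt n
toℤ []       = []
toℤ (b ∷ bs) = b2z b ∷ toℤ bs

hypersimplex : (k n : ℕ) → List (Pt n)
hypersimplex k n = map toℤ (combos n k)

-- The lifting κ_{k,n}: the vertex v_i (1-based i) gets height 1 iff
-- 1 ≤ i ≤ C(n-1,k-1) - 1, else 0.  Here pos is the 0-based position.

liftFrom : ∀ {n} → (threshold pos : ℕ) → List (Pt n) → List (Pt (suc n))
liftFrom t pos []       = []
liftFrom t pos (v ∷ vs) with pos <? t
... | yes _ = (v ∷ʳ + 1) ∷ liftFrom t (suc pos) vs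
... | no  _ = (v ∷ʳ + 0) ∷ liftFrom t (suc pos) vs

liftedHypersimplex : (k n : ℕ) → List (Pt (suc n))
liftedHypersimplex k n = liftFrom (((n ∸ 1) C (k ∸ 1)) ∸ 1) 0 (hypersimplex k n)

gfun : (n i : ℕ) → Pt (suc n) → ℤ
gfun n i x = (- nth x 0) + nth x (i ∸ 1) + nth x n

zeroSet : (k n i : ℕ) → List (Pt (suc n))
zeroSet k n i = filter (λ x → gfun n i x ≟ + 0) (liftedHypersimplex k n)

sumV : ∀ {m} → Vec ℤ m → ℤ
sumV []       = + 0
sumV (x ∷ xs) = x + sumV xs

dot : ∀ {m} → Pt m → Pt m → ℤ
dot []       []       = + 0
dot (x ∷ xs) (y ∷ ys) = x * y + dot xs ys

zeroV : ∀ {m} → Pt m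
zeroV = replicate _ (+ 0)

addV : ∀ {m} → Pt m → Pt m → Pt m
addV []       []       = []
addV (x ∷ xs) (y ∷ ys) = (x + y) ∷ addV xs ys

scaleV : ∀ {m} → ℤ → Pt m → Pt m
scaleV c []       = []
scaleV c (x ∷ xs) = (c * x) ∷ scaleV c xs

combo : ∀ {m} (L : List (Pt m)) → Vec ℤ (length L) → Pt m
combo []       []       = zeroV
combo (p ∷ L) (l ∷ ls) = addV (scaleV l p) (combo L ls)

-- Affine independence of a finite list of points (over ℚ, equivalently
-- with integer coefficients after clearing denominators).
AffIndep : ∀ {m} → List (Pt m) → Set
AffIndep L = (λs : Vec ℤ (length L)) → sumV λs ≡ + 0 → combo L λs ≡ zeroV →
             λs ≡ replicate _ (+ 0)

HasAffIndep : ∀ {m} → List (Pt m) → ℕ → Set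
HasAffIndep {m} S r = Σ (List (Pt m)) λ L → length L ≡ r × All (_∈ S) L × AffIndep L

AffDim : ∀ {m} → List (Pt m) → ℕ → Set
AffDim S d = HasAffIndep S (suc d) × ¬ HasAffIndep S (suc (suc d))

-- conv(F) is a face of conv(P) with outer normal c (c·x ≤ c₀ on P,
-- equality exactly on F) whose last coordinate is negative.
IsLowerFace : ∀ {m} → List (Pt (suc m)) → List (Pt (suc m)) → Set
IsLowerFace {m} P F =
  Σ (Pt (suc m)) λ c → Σ ℤ λ c₀ →
    All (λ x → dot c x Data.Integer.≤ c₀) P ×
    All (λ x → x ∈ F) (filter (λ x → dot c x ≟ c₀) P) ×
    All (λ x → x ∈ P × dot c x ≡ c₀) F ×
    nth c m Data.Integer.< + 0

IsLowerFacet : ∀ {m} → List (Pt (suc m)) → List (Pt (suc m)) → Set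
IsLowerFacet P F = IsLowerFace P F × Σ ℕ λ d → AffDim F d × AffDim P (suc d)

-- Lattice isomorphism between lattice polytopes conv(S), conv(T)
-- (S, T their vertex sets): integral affine maps φ, ψ mapping S onto T
-- and T onto S, mutually inverse on the vertices (hence on the affine
-- hulls and their lattice points).

AffMap : ℕ → ℕ → Set
AffMap a b = Vec (Pt a) b × Pt b

applyA : ∀ {a b} → AffMap a b → Pt a → Pt b
applyA {b = zero}  ([] , [])         x = []
applyA {b = suc b} ((r ∷ rs) , (t ∷ ts)) x = (dot r x + t) ∷ applyA (rs , ts) x

LatticeIso : ∀ {a b} → List (Pt a) → List (Pt b) → Set
LatticeIso {a} {b} S T =
  Σ (AffMap a b) λ φ → Σ (AffMap b a) λ ψ →
    All (λ p → applyA φ p ∈ T) S × All (λ q → applyA ψ q ∈ S) T ×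
    All (λ p → applyA ψ (applyA φ p) ≡ p) S ×
    All (λ q → applyA φ (applyA ψ q) ≡ q) T

-- apex a at lattice distance one from aff(Q'): some integral affine
-- function vanishes on Q' and takes value 1 at a
LatticeDistOne : ∀ {m} → Pt m → List (Pt m) → Set
LatticeDistOne {m} a Q′ =
  Σ (Pt m) λ ℓ → Σ ℤ λ c → All (λ q → dot ℓ q + c ≡ + 0) Q′ × dot ℓ a + c ≡ + 1

-- conv(F) is lattice isomorphic to a pyramid of lattice height one over
-- conv(Q): there is Q′ ⊂ ℤ^m lattice isomorphic to Q and an apex a at
-- lattice distance one from aff(Q′), with conv(F) ≅ conv(Q′ ∪ {a}).
IsoToPyramidOver : ∀ {a b} → List (Pt a) → List (Pt b) → Set
IsoToPyramidOver F Q =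
  Σ ℕ λ m → Σ (List (Pt m)) λ Q′ → Σ (Pt m) λ apex →
    LatticeIso Q′ Q × LatticeDistOne apex Q′ × LatticeIso F (apex ∷ Q′)

{-# OPTIONS --safe #-}
module Submission where

-- g_i vanishes at the corner (1, 0…01…1, 0), the one vertex with first coordinate 1 left at height 0,
-- and every other vertex lies on x_1 = x_{n+1}, where g_i = x_i ≥ 0. So g_i ≥ 0 on Δ̃(k,n) and its zero
-- set is a lower face: the corner together with the vertices (b, v, b) having x_i = 0. Deleting x_i and
-- the height maps the latter onto the vertices of Δ(k, n-1), and x_i = 1 at the corner, so the face is a
-- pyramid of height one over Δ(k, n-1). It is a facet: explicit affinely independent vertices bound the
-- dimensions from below, and Gaussian elimination over ℤ bounds them from above, since every vertex lies
-- on Σ_{j ≤ n} x_j = k and the face on g_i = 0. A vertex (0, v, 0) with x_i = 1 and x_j = 0 separates the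
-- facets cut out by g_i and g_j.

open import Defs
open import Data.Nat using (ℕ; _≤_; _+_; _∸_)
open import Data.Integer using (+_) renaming (_≤_ to _≤ℤ_)
open import Data.List.Relation.Unary.All using (All)
open import Data.List.Membership.Propositional using (_∈_)
open import Data.Product using (_×_)
open import Relation.Nullary using (¬_)
open import Relation.Binary.PropositionalEquality using (_≢_)

open import Data.Nat using (zero; suc; _<_; z≤n; s≤s; _<ᵇ_; _<?_)
import Data.Nat.Properties as ℕP
open import Data.Nat.Combinatorics using (_C_; nCk+nC[k+1]≡[n+1]C[k+1])
open import Data.Integer using (ℤ; -_; -[1+_]; +≤+; -<+)
  renaming (_+_ to _+ᶻ_; _*_ to _*ᶻ_; _-_ to _-ᶻ_; _<_ to _<ℤ_)
import Data.Integer as ℤ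
import Data.Integer.Properties as ℤP
open import Data.Integer.Tactic.RingSolver using (solve-∀)
open import Data.Bool using (Bool; true; false; if_then_else_)
open import Data.Vec as V using (Vec; []; _∷_; _∷ʳ_; replicate)
import Data.Vec.Properties as VP
open import Data.List as L using (List; []; _∷_; _++_; map; length)
import Data.List.Properties as LP
open import Data.List.Relation.Unary.All as All using ([]; _∷_)
import Data.List.Relation.Unary.All.Properties as AllP
open import Data.List.Relation.Unary.Any as Any using (Any; here; there)
import Data.List.Relation.Unary.Any.Properties as AnyP
open import Data.List.Membership.Propositional using (find)
open import Data.List.Membership.Propositional.Properties
open import Data.Product using (Σ; _,_; proj₁; proj₂)
open import Data.Sum using (inj₁; inj₂)
open import Data.Empty using (⊥-elim)
open import Relation.Nullary using (yes; no)
open import Function using (_∘_; case_of_)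
open import Relation.Binary.Definitions using (tri<; tri≈; tri>)
open import Relation.Binary.PropositionalEquality
  using (_≡_; refl; sym; trans; cong; cong₂; subst; module ≡-Reasoning)

nth-ext : ∀ {m} (x y : Pt m) → (∀ j → j < m → nth x j ≡ nth y j) → x ≡ y
nth-ext []      []      _ = refl
nth-ext (a ∷ x) (b ∷ y) h = cong₂ _∷_ (h 0 (s≤s z≤n)) (nth-ext x y (λ j j<m → h (suc j) (s≤s j<m)))

nth-addV : ∀ {m} (x y : Pt m) j → nth (addV x y) j ≡ nth x j +ᶻ nth y j
nth-addV []      []      j       = refl
nth-addV (a ∷ x) (b ∷ y) zero    = refl
nth-addV (a ∷ x) (b ∷ y) (suc j) = nth-addV x y j

nth-scaleV : ∀ {m} c (x : Pt m) j → nth (scaleV c x) j ≡ c *ᶻ nth x j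
nth-scaleV c []      j       = sym (ℤP.*-zeroʳ c)
nth-scaleV c (a ∷ x) zero    = refl
nth-scaleV c (a ∷ x) (suc j) = nth-scaleV c x j

nth-zeroV : ∀ m j → nth (zeroV {m}) j ≡ + 0
nth-zeroV zero    j       = refl
nth-zeroV (suc m) zero    = refl
nth-zeroV (suc m) (suc j) = nth-zeroV m j

addV-comm : ∀ {m} (x y : Pt m) → addV x y ≡ addV y x
addV-comm []      []      = refl
addV-comm (a ∷ x) (b ∷ y) = cong₂ _∷_ (ℤP.+-comm a b) (addV-comm x y)

addV-swap : ∀ {m} (x y z : Pt m) → addV x (addV y z) ≡ addV y (addV x z)
addV-swap []      []      []      = refl
addV-swap (a ∷ x) (b ∷ y) (c ∷ z) = cong₂ _∷_ (swap a b c) (addV-swap x y z)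
  where swap : ∀ a b c → a +ᶻ (b +ᶻ c) ≡ b +ᶻ (a +ᶻ c)
        swap = solve-∀

addV-scaleV-0 : ∀ {m} (p x : Pt m) → addV (scaleV (+ 0) p) x ≡ x
addV-scaleV-0 []      []      = refl
addV-scaleV-0 (a ∷ p) (b ∷ x) = cong₂ _∷_ (trans (cong (_+ᶻ b) (ℤP.*-zeroˡ a)) (ℤP.+-identityˡ b)) (addV-scaleV-0 p x)

dot-addVʳ : ∀ {m} (w x y : Pt m) → dot w (addV x y) ≡ dot w x +ᶻ dot w y
dot-addVʳ []      []      []      = refl
dot-addVʳ (c ∷ w) (a ∷ x) (b ∷ y) rewrite dot-addVʳ w x y = distrib c a b (dot w x) (dot w y)
  where distrib : ∀ c a b u v → c *ᶻ (a +ᶻ b) +ᶻ (u +ᶻ v) ≡ (c *ᶻ a +ᶻ u) +ᶻ (c *ᶻ b +ᶻ v)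
        distrib = solve-∀

dot-scaleVʳ : ∀ {m} (w : Pt m) c x → dot w (scaleV c x) ≡ c *ᶻ dot w x
dot-scaleVʳ []      c []      = sym (ℤP.*-zeroʳ c)
dot-scaleVʳ (d ∷ w) c (a ∷ x) rewrite dot-scaleVʳ w c x = distrib d c a (dot w x)
  where distrib : ∀ d c a u → d *ᶻ (c *ᶻ a) +ᶻ c *ᶻ u ≡ c *ᶻ (d *ᶻ a +ᶻ u)
        distrib = solve-∀

dot-zeroVʳ : ∀ {m} (w : Pt m) → dot w zeroV ≡ + 0
dot-zeroVʳ []      = refl
dot-zeroVʳ (d ∷ w) rewrite dot-zeroVʳ w | ℤP.*-zeroʳ d = refl

dot-addVˡ : ∀ {m} (a b x : Pt m) → dot (addV a b) x ≡ dot a x +ᶻ dot b x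
dot-addVˡ []       []       []       = refl
dot-addVˡ (a ∷ as) (b ∷ bs) (y ∷ ys) rewrite dot-addVˡ as bs ys = distrib a b y (dot as ys) (dot bs ys)
  where distrib : ∀ a b y u v → (a +ᶻ b) *ᶻ y +ᶻ (u +ᶻ v) ≡ a *ᶻ y +ᶻ u +ᶻ (b *ᶻ y +ᶻ v)
        distrib = solve-∀

dot-scaleVˡ : ∀ {m} c (a x : Pt m) → dot (scaleV c a) x ≡ c *ᶻ dot a x
dot-scaleVˡ c []       []       = sym (ℤP.*-zeroʳ c)
dot-scaleVˡ c (a ∷ as) (y ∷ ys) rewrite dot-scaleVˡ c as ys = distrib c a y (dot as ys)
  where distrib : ∀ c a y u → c *ᶻ a *ᶻ y +ᶻ c *ᶻ u ≡ c *ᶻ (a *ᶻ y +ᶻ u)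
        distrib = solve-∀

dot-zeroVˡ : ∀ {m} (x : Pt m) → dot zeroV x ≡ + 0
dot-zeroVˡ []      = refl
dot-zeroVˡ (a ∷ x) = trans (ℤP.+-identityˡ _) (dot-zeroVˡ x)

dot-∷ʳ : ∀ {m} (a x : Pt m) c d → dot (a ∷ʳ c) (x ∷ʳ d) ≡ dot a x +ᶻ c *ᶻ d
dot-∷ʳ []       []       c d = trans (ℤP.+-identityʳ (c *ᶻ d)) (sym (ℤP.+-identityˡ (c *ᶻ d)))
dot-∷ʳ (a ∷ as) (x ∷ xs) c d rewrite dot-∷ʳ as xs c d = sym (ℤP.+-assoc (a *ᶻ x) _ _)

unitV : (m j : ℕ) → Pt m
unitV zero    j       = []
unitV (suc m) zero    = + 1 ∷ zeroV
unitV (suc m) (suc j) = + 0 ∷ unitV m j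

dot-unitV : ∀ m j (x : Pt m) → dot (unitV m j) x ≡ nth x j
dot-unitV zero    j       []      = refl
dot-unitV (suc m) zero    (a ∷ x) rewrite dot-zeroVˡ x = trans (ℤP.+-identityʳ _) (ℤP.*-identityˡ a)
dot-unitV (suc m) (suc j) (a ∷ x) = trans (ℤP.+-identityˡ _) (dot-unitV m j x)

nth-unitV-≡ : ∀ m j → j < m → nth (unitV m j) j ≡ + 1
nth-unitV-≡ (suc m) zero    _         = refl
nth-unitV-≡ (suc m) (suc j) (s≤s j<m) = nth-unitV-≡ m j j<m

nth-unitV-≢ : ∀ m j j′ → j ≢ j′ → nth (unitV m j) j′ ≡ + 0
nth-unitV-≢ zero    j       j′       _   = refl
nth-unitV-≢ (suc m) zero    zero     j≢j′ = ⊥-elim (j≢j′ refl)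
nth-unitV-≢ (suc m) zero    (suc j′) _   = nth-zeroV m j′
nth-unitV-≢ (suc m) (suc j) zero     _   = refl
nth-unitV-≢ (suc m) (suc j) (suc j′) j≢j′ = nth-unitV-≢ m j j′ (λ e → j≢j′ (cong suc e))

lincomb : ∀ {m} → List (Pt m) → List ℤ → Pt m
lincomb []      _        = zeroV
lincomb (p ∷ P) []       = zeroV
lincomb (p ∷ P) (w ∷ ws) = addV (scaleV w p) (lincomb P ws)

dotL : List ℤ → List ℤ → ℤ
dotL []       _        = + 0
dotL (w ∷ ws) []       = + 0
dotL (w ∷ ws) (a ∷ as) = w *ᶻ a +ᶻ dotL ws as

sumL : List ℤ → ℤ
sumL []       = + 0
sumL (w ∷ ws) = w +ᶻ sumL ws

nth-lincomb : ∀ {m} (P : List (Pt m)) ws j → nth (lincomb P ws) j ≡ dotL ws (map (λ p → nth p j) P)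
nth-lincomb {m} []      []       j = nth-zeroV m j
nth-lincomb {m} []      (w ∷ ws) j = nth-zeroV m j
nth-lincomb {m} (p ∷ P) []       j = nth-zeroV m j
nth-lincomb     (p ∷ P) (w ∷ ws) j =
  trans (nth-addV (scaleV w p) (lincomb P ws) j) (cong₂ _+ᶻ_ (nth-scaleV w p j) (nth-lincomb P ws j))

dot-lincomb : ∀ {m} (w : Pt m) P ws → dot w (lincomb P ws) ≡ dotL ws (map (dot w) P)
dot-lincomb w []      []       = dot-zeroVʳ w
dot-lincomb w []      (c ∷ ws) = dot-zeroVʳ w
dot-lincomb w (p ∷ P) []       = dot-zeroVʳ w
dot-lincomb w (p ∷ P) (c ∷ ws) =
  trans (dot-addVʳ w (scaleV c p) (lincomb P ws)) (cong₂ _+ᶻ_ (dot-scaleVʳ w c p) (dot-lincomb w P ws))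

lincomb-head-tail : ∀ {m} (P : List (Pt (suc m))) ws →
  lincomb P ws ≡ dotL ws (map V.head P) ∷ lincomb (map V.tail P) ws
lincomb-head-tail []            []       = refl
lincomb-head-tail []            (w ∷ ws) = refl
lincomb-head-tail (p ∷ P)       []       = refl
lincomb-head-tail ((a ∷ p) ∷ P) (w ∷ ws) rewrite lincomb-head-tail P ws = refl

lincomb-∷ : ∀ {m} c (P : List (Pt m)) ws → lincomb (map (c ∷_) P) ws ≡ dotL ws (map (λ _ → c) P) ∷ lincomb P ws
lincomb-∷ c P ws = trans (lincomb-head-tail (map (c ∷_) P) ws)
  (cong₂ (λ H T → dotL ws H ∷ lincomb T ws) (sym (LP.map-∘ P)) (trans (sym (LP.map-∘ P)) (LP.map-id P)))

dotL-const : ∀ {A : Set} (f : A → ℤ) c ws (P : List A) → length ws ≡ length P → All (λ p → f p ≡ c) P →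
  dotL ws (map f P) ≡ sumL ws *ᶻ c
dotL-const f c []       []      _ _ = sym (ℤP.*-zeroˡ c)
dotL-const f c (w ∷ ws) (p ∷ P) e (fp≡c ∷ f≡c) rewrite dotL-const f c ws P (ℕP.suc-injective e) f≡c | fp≡c =
  sym (ℤP.*-distribʳ-+ c w (sumL ws))

dotL-zeros : ∀ {A : Set} ws (P : List A) → dotL ws (map (λ _ → + 0) P) ≡ + 0
dotL-zeros []       P       = refl
dotL-zeros (w ∷ ws) []      = refl
dotL-zeros (w ∷ ws) (p ∷ P) rewrite dotL-zeros ws P | ℤP.*-zeroʳ w = refl

dotL-scaleˡ : ∀ a ws xs → dotL (map (a *ᶻ_) ws) xs ≡ a *ᶻ dotL ws xs
dotL-scaleˡ a []       xs       = sym (ℤP.*-zeroʳ a)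
dotL-scaleˡ a (w ∷ ws) []       = sym (ℤP.*-zeroʳ a)
dotL-scaleˡ a (w ∷ ws) (x ∷ xs) rewrite dotL-scaleˡ a ws xs = distrib a w x (dotL ws xs)
  where distrib : ∀ a w x u → a *ᶻ w *ᶻ x +ᶻ a *ᶻ u ≡ a *ᶻ (w *ᶻ x +ᶻ u)
        distrib = solve-∀

lincomb-scale : ∀ {m} (P : List (Pt m)) a ws → lincomb P (map (a *ᶻ_) ws) ≡ scaleV a (lincomb P ws)
lincomb-scale P a ws = nth-ext _ _ λ j _ → begin
  nth (lincomb P (map (a *ᶻ_) ws)) j         ≡⟨ nth-lincomb P (map (a *ᶻ_) ws) j ⟩
  dotL (map (a *ᶻ_) ws) (map (λ p → nth p j) P) ≡⟨ dotL-scaleˡ a ws _ ⟩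
  a *ᶻ dotL ws (map (λ p → nth p j) P)        ≡⟨ cong (a *ᶻ_) (nth-lincomb P ws j) ⟨
  a *ᶻ nth (lincomb P ws) j                   ≡⟨ nth-scaleV a (lincomb P ws) j ⟨
  nth (scaleV a (lincomb P ws)) j             ∎
  where open ≡-Reasoning

lincomb-insert : ∀ {m} (Pre : List (Pt m)) p Post μ₁ c μ₂ → length μ₁ ≡ length Pre →
  lincomb (Pre ++ p ∷ Post) (μ₁ ++ c ∷ μ₂) ≡ addV (scaleV c p) (lincomb (Pre ++ Post) (μ₁ ++ μ₂))
lincomb-insert []      p Post []       c μ₂ _ = refl
lincomb-insert (q ∷ Pre) p Post (w ∷ μ₁) c μ₂ e =
  trans (cong (addV (scaleV w q)) (lincomb-insert Pre p Post μ₁ c μ₂ (ℕP.suc-injective e)))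
        (addV-swap (scaleV w q) (scaleV c p) _)

length-++-∷ : ∀ {A : Set} (xs : List A) y ys → length (xs ++ y ∷ ys) ≡ suc (length (xs ++ ys))
length-++-∷ []       y ys = refl
length-++-∷ (x ∷ xs) y ys = cong suc (length-++-∷ xs y ys)

*-≢0 : ∀ a w → a ≢ + 0 → w ≢ + 0 → a *ᶻ w ≢ + 0
*-≢0 a w a≢0 w≢0 aw≡0 with ℤP.i*j≡0⇒i≡0∨j≡0 a aw≡0
... | inj₁ a≡0 = a≢0 a≡0
... | inj₂ w≡0 = w≢0 w≡0

Dependent : ∀ {m} → List (Pt m) → Set
Dependent P = Σ (List ℤ) λ ws → length ws ≡ length P × Any (_≢ + 0) ws × lincomb P ws ≡ zeroV

dependent-heads-zero : ∀ {m} (P : List (Pt m)) → Dependent P → Dependent (map (+ 0 ∷_) P)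
dependent-heads-zero P (ws , len , nz , dep) =
  ws , trans len (sym (LP.length-map _ P)) , nz ,
  trans (lincomb-∷ (+ 0) P ws) (cong₂ _∷_ (dotL-zeros ws P) dep)

eliminate : ∀ {m} → ℤ → Pt m → Pt (suc m) → Pt m
eliminate a v (b ∷ w) = addV (scaleV a w) (scaleV (- b) v)

dotL-eliminate : ∀ {m} a (v : Pt m) j (R : List (Pt (suc m))) μ →
  dotL μ (map (λ p → nth p j) (map (eliminate a v) R))
    ≡ a *ᶻ dotL μ (map (λ p → nth p j) (map V.tail R)) +ᶻ (- dotL μ (map V.head R)) *ᶻ nth v j
dotL-eliminate a v j R             []      = sym (cong₂ _+ᶻ_ (ℤP.*-zeroʳ a) (ℤP.*-zeroˡ (nth v j)))
dotL-eliminate a v j []            (w ∷ μ) = sym (cong₂ _+ᶻ_ (ℤP.*-zeroʳ a) (ℤP.*-zeroˡ (nth v j)))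
dotL-eliminate a v j ((b ∷ p) ∷ R) (w ∷ μ)
  rewrite dotL-eliminate a v j R μ | nth-addV (scaleV a p) (scaleV (- b) v) j | nth-scaleV a p j | nth-scaleV (- b) v j
  = step w a (nth p j) b (nth v j) (dotL μ (map (λ p → nth p j) (map V.tail R))) (dotL μ (map V.head R))
  where step : ∀ w a x b y t s → w *ᶻ (a *ᶻ x +ᶻ (- b) *ᶻ y) +ᶻ (a *ᶻ t +ᶻ (- s) *ᶻ y)
                                   ≡ a *ᶻ (w *ᶻ x +ᶻ t) +ᶻ (- (w *ᶻ b +ᶻ s)) *ᶻ y
        step = solve-∀

lincomb-eliminate : ∀ {m} a (v : Pt m) (R : List (Pt (suc m))) μ →
  lincomb (map (eliminate a v) R) μ ≡ addV (scaleV a (lincomb (map V.tail R) μ)) (scaleV (- dotL μ (map V.head R)) v)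
lincomb-eliminate {m} a v R μ = nth-ext _ _ λ j _ →
  trans (nth-lincomb (map (eliminate a v) R) μ j)
  (trans (dotL-eliminate a v j R μ)
  (sym (trans (nth-addV (scaleV a tailSum) (scaleV (- headSum) v) j)
              (cong₂ _+ᶻ_ (trans (nth-scaleV a tailSum j) (cong (a *ᶻ_) (nth-lincomb (map V.tail R) μ j)))
                          (nth-scaleV (- headSum) v j)))))
  where
  tailSum : Pt m
  tailSum = lincomb (map V.tail R) μ
  headSum : ℤ
  headSum = dotL μ (map V.head R)

dependent-pivot : ∀ {m} (Pre : List (Pt (suc m))) a v Post → a ≢ + 0 →
  Dependent (map (eliminate a v) (Pre ++ Post)) → Dependent (Pre ++ (a ∷ v) ∷ Post)
dependent-pivot {m} Pre a v Post a≢0 (μ , len , nz , dep) = ws , length-ws , nz-ws , dep-ws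
  where
  R : List (Pt (suc m))
  R = Pre ++ Post
  S : ℤ
  S = dotL μ (map V.head R)
  aμ μ₁ μ₂ ws : List ℤ
  aμ = map (a *ᶻ_) μ
  μ₁ = L.take (length Pre) aμ
  μ₂ = L.drop (length Pre) aμ
  ws = μ₁ ++ (- S) ∷ μ₂

  length-aμ : length aμ ≡ length R
  length-aμ = trans (LP.length-map _ μ) (trans len (LP.length-map _ R))

  length-μ₁ : length μ₁ ≡ length Pre
  length-μ₁ = trans (LP.length-take (length Pre) aμ) (ℕP.m≤n⇒m⊓n≡m
    (subst (length Pre ≤_) (sym (trans length-aμ (LP.length-++ Pre))) (ℕP.m≤m+n _ _)))

  length-ws : length ws ≡ length (Pre ++ (a ∷ v) ∷ Post)
  length-ws = trans (length-++-∷ μ₁ (- S) μ₂)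
    (trans (cong (suc ∘ length) (LP.take++drop≡id (length Pre) aμ))
    (trans (cong suc length-aμ) (sym (length-++-∷ Pre (a ∷ v) Post))))

  nz-ws : Any (_≢ + 0) ws
  nz-ws with AnyP.++⁻ μ₁ (subst (Any (_≢ + 0)) (sym (LP.take++drop≡id (length Pre) aμ))
                            (AnyP.map⁺ (Any.map (*-≢0 a _ a≢0) nz)))
  ... | inj₁ in-μ₁ = AnyP.++⁺ˡ in-μ₁
  ... | inj₂ in-μ₂ = AnyP.++⁺ʳ μ₁ (there in-μ₂)

  tails-vanish : addV (scaleV (- S) v) (scaleV a (lincomb (map V.tail R) μ)) ≡ zeroV
  tails-vanish = trans (addV-comm _ _) (trans (sym (lincomb-eliminate a v R μ)) dep)

  heads-vanish : ∀ x y → (- y) *ᶻ x +ᶻ x *ᶻ y ≡ + 0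
  heads-vanish = solve-∀

  dep-ws : lincomb (Pre ++ (a ∷ v) ∷ Post) ws ≡ zeroV
  dep-ws = begin
    lincomb (Pre ++ (a ∷ v) ∷ Post) ws
      ≡⟨ lincomb-insert Pre (a ∷ v) Post μ₁ (- S) μ₂ length-μ₁ ⟩
    addV pivot (lincomb R (μ₁ ++ μ₂))
      ≡⟨ cong (addV pivot ∘ lincomb R) (LP.take++drop≡id (length Pre) aμ) ⟩
    addV pivot (lincomb R aμ)
      ≡⟨ cong (addV pivot) (lincomb-scale R a μ) ⟩
    addV pivot (scaleV a (lincomb R μ))
      ≡⟨ cong (addV pivot ∘ scaleV a) (lincomb-head-tail R μ) ⟩
    ((- S) *ᶻ a +ᶻ a *ᶻ S) ∷ addV (scaleV (- S) v) (scaleV a (lincomb (map V.tail R) μ))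
      ≡⟨ cong₂ _∷_ (heads-vanish a S) tails-vanish ⟩
    zeroV ∎
    where
    open ≡-Reasoning
    pivot : Pt (suc m)
    pivot = scaleV (- S) (a ∷ v)

-- Gaussian elimination: pivot on a point with nonzero first coordinate if there is one, else drop that coordinate.
dim<length⇒dependent : ∀ m (P : List (Pt m)) → m < length P → Dependent P
dim<length⇒dependent zero (p ∷ P) _ =
  + 1 ∷ L.replicate (length P) (+ 0) , cong suc (LP.length-replicate (length P)) , here (λ ()) , empty _
  where
  empty : (x : Pt 0) → x ≡ zeroV
  empty [] = refl
dim<length⇒dependent (suc m) P m<len with All.all? (λ x → V.head x ℤ.≟ + 0) P
... | yes heads≡0 =
  subst Dependent (trans (sym (LP.map-∘ P)) (LP.map-id-local (All.map cons-tail heads≡0)))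
        (dependent-heads-zero (map V.tail P)
          (dim<length⇒dependent m (map V.tail P) (subst (suc m ≤_) (sym (LP.length-map V.tail P)) (ℕP.<⇒≤ m<len))))
  where
  cons-tail : ∀ {x : Pt (suc m)} → V.head x ≡ + 0 → + 0 ∷ V.tail x ≡ x
  cons-tail {a ∷ x} a≡0 = cong (_∷ x) (sym a≡0)
... | no ¬heads≡0 with find (AllP.¬All⇒Any¬ (λ x → V.head x ℤ.≟ + 0) P ¬heads≡0)
...   | a ∷ v , x∈P , a≢0 with ∈-∃++ x∈P
...     | Pre , Post , refl =
  dependent-pivot Pre a v Post a≢0 (dim<length⇒dependent m (map (eliminate a v) (Pre ++ Post))
    (subst (m <_) (sym (LP.length-map _ (Pre ++ Post)))
                  (ℕP.≤-pred (subst (suc m <_) (length-++-∷ Pre (a ∷ v) Post) m<len))))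

AffIndepL : ∀ {m} → List (Pt m) → Set
AffIndepL P = ∀ ws → length ws ≡ length P → sumL ws ≡ + 0 → lincomb P ws ≡ zeroV → All (_≡ + 0) ws

combo-toList : ∀ {m} (P : List (Pt m)) λs → combo P λs ≡ lincomb P (V.toList λs)
combo-toList []      []       = refl
combo-toList (p ∷ P) (l ∷ λs) = cong (addV (scaleV l p)) (combo-toList P λs)

sumV-toList : ∀ {n} (λs : Vec ℤ n) → sumV λs ≡ sumL (V.toList λs)
sumV-toList []       = refl
sumV-toList (l ∷ λs) = cong (l +ᶻ_) (sumV-toList λs)

toList-zeros : ∀ {n} (λs : Vec ℤ n) → All (_≡ + 0) (V.toList λs) → λs ≡ replicate n (+ 0)
toList-zeros []       []             = refl
toList-zeros (l ∷ λs) (l≡0 ∷ λs≡0) = cong₂ _∷_ l≡0 (toList-zeros λs λs≡0)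

zeros-toList : ∀ n → All (_≡ + 0) (V.toList (replicate n (+ 0)))
zeros-toList zero    = []
zeros-toList (suc n) = refl ∷ zeros-toList n

toList-surjective : ∀ {A : Set} (P : List A) ws → length ws ≡ length P →
  Σ (Vec ℤ (length P)) λ λs → V.toList λs ≡ ws
toList-surjective []      []       _   = [] , refl
toList-surjective (p ∷ P) (w ∷ ws) len with toList-surjective P ws (ℕP.suc-injective len)
... | λs , refl = w ∷ λs , refl

affIndepL⇒affIndep : ∀ {m} (P : List (Pt m)) → AffIndepL P → AffIndep P
affIndepL⇒affIndep P indep λs sum≡0 combo≡0 = toList-zeros λs
  (indep (V.toList λs) (VP.length-toList λs) (trans (sym (sumV-toList λs)) sum≡0)
         (trans (sym (combo-toList P λs)) combo≡0))

affIndep⇒affIndepL : ∀ {m} (P : List (Pt m)) → AffIndep P → AffIndepL P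
affIndep⇒affIndepL P indep ws len sum≡0 lincomb≡0 with toList-surjective P ws len
... | λs , refl = subst (All (_≡ + 0) ∘ V.toList) (sym λs≡0) (zeros-toList (length P))
  where
  λs≡0 : λs ≡ replicate (length P) (+ 0)
  λs≡0 = indep λs (trans (sumV-toList λs) sum≡0) (trans (combo-toList P λs) lincomb≡0)

-- An affine dependence of P is a linear dependence of the points (1, p).
dependent-homogenised⇒¬affIndep : ∀ {m} (P : List (Pt m)) → Dependent (map (+ 1 ∷_) P) → ¬ AffIndep P
dependent-homogenised⇒¬affIndep P (ws , len , nz , dep) indep =
  AllP.All¬⇒¬Any (All.map (λ w≡0 w≢0 → w≢0 w≡0) ws≡0) nz
  where
  len′ : length ws ≡ length P
  len′ = trans len (LP.length-map _ P)
  split : dotL ws (map (λ _ → + 1) P) ∷ lincomb P ws ≡ zeroV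
  split = trans (sym (lincomb-∷ (+ 1) P ws)) dep
  sum≡0 : sumL ws ≡ + 0
  sum≡0 = trans (sym (ℤP.*-identityʳ (sumL ws)))
          (trans (sym (dotL-const (λ _ → + 1) (+ 1) ws P len′ (All.tabulate (λ _ → refl)))) (VP.∷-injectiveˡ split))
  ws≡0 : All (_≡ + 0) ws
  ws≡0 = affIndep⇒affIndepL P indep ws len′ sum≡0 (VP.∷-injectiveʳ split)

dependent-from-tails : ∀ {m} (w : Pt (suc m)) → V.head w ≢ + 0 → (P : List (Pt (suc m))) →
  All (λ x → dot w x ≡ + 0) P → Dependent (map V.tail P) → Dependent P
dependent-from-tails (w₀ ∷ w) w₀≢0 P on-w (ws , len , nz , dep) =
  ws , trans len (LP.length-map _ P) , nz , trans split (cong (_∷ zeroV) h≡0)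
  where
  h : ℤ
  h = dotL ws (map V.head P)
  split : lincomb P ws ≡ h ∷ zeroV
  split = trans (lincomb-head-tail P ws) (cong (h ∷_) dep)
  w₀h≡0 : w₀ *ᶻ h ≡ + 0
  w₀h≡0 = begin
    w₀ *ᶻ h                    ≡⟨ ℤP.+-identityʳ _ ⟨
    w₀ *ᶻ h +ᶻ + 0             ≡⟨ cong (w₀ *ᶻ h +ᶻ_) (dot-zeroVʳ w) ⟨
    dot (w₀ ∷ w) (h ∷ zeroV)   ≡⟨ cong (dot (w₀ ∷ w)) split ⟨
    dot (w₀ ∷ w) (lincomb P ws) ≡⟨ dot-lincomb (w₀ ∷ w) P ws ⟩
    dotL ws (map (dot (w₀ ∷ w)) P) ≡⟨ dotL-const _ (+ 0) ws P (trans len (LP.length-map _ P)) on-w ⟩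
    sumL ws *ᶻ + 0             ≡⟨ ℤP.*-zeroʳ (sumL ws) ⟩
    + 0                        ∎
    where open ≡-Reasoning
  h≡0 : h ≡ + 0
  h≡0 with ℤP.i*j≡0⇒i≡0∨j≡0 w₀ w₀h≡0
  ... | inj₁ w₀≡0 = ⊥-elim (w₀≢0 w₀≡0)
  ... | inj₂ h≡0  = h≡0

affIndepL-[_] : ∀ {m} (p : Pt m) → AffIndepL (p ∷ [])
affIndepL-[ p ] (μ ∷ []) _ sum≡0 _ = trans (sym (ℤP.+-identityʳ μ)) sum≡0 ∷ []

-- Applying w to an affine dependence forces the weight of p to vanish.
affIndepL-∷ : ∀ {m} (w : Pt m) c p (P : List (Pt m)) → AffIndepL P →
  All (λ q → dot w q ≡ c) P → dot w p ≢ c → AffIndepL (p ∷ P)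
affIndepL-∷ w c p P indep on-w off-w (μ ∷ ws) len sum≡0 lincomb≡0 =
  μ≡0 ∷ indep ws len′ (trans Σws≡-μ (cong -_ μ≡0)) rest≡0
  where
  len′ : length ws ≡ length P
  len′ = ℕP.suc-injective len
  shift : ∀ μ s → s ≡ (μ +ᶻ s) +ᶻ (- μ)
  shift = solve-∀
  Σws≡-μ : sumL ws ≡ - μ
  Σws≡-μ = trans (shift μ (sumL ws)) (trans (cong (_+ᶻ (- μ)) sum≡0) (ℤP.+-identityˡ (- μ)))
  applied : μ *ᶻ dot w p +ᶻ sumL ws *ᶻ c ≡ + 0
  applied = begin
    μ *ᶻ dot w p +ᶻ sumL ws *ᶻ c
      ≡⟨ cong₂ _+ᶻ_ (dot-scaleVʳ w μ p) (trans (dot-lincomb w P ws) (dotL-const (dot w) c ws P len′ on-w)) ⟨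
    dot w (scaleV μ p) +ᶻ dot w (lincomb P ws)
      ≡⟨ dot-addVʳ w (scaleV μ p) (lincomb P ws) ⟨
    dot w (lincomb (p ∷ P) (μ ∷ ws))
      ≡⟨ cong (dot w) lincomb≡0 ⟩
    dot w zeroV
      ≡⟨ dot-zeroVʳ w ⟩
    + 0 ∎
    where open ≡-Reasoning
  factor : ∀ μ x c → μ *ᶻ (x -ᶻ c) ≡ μ *ᶻ x +ᶻ (- μ) *ᶻ c
  factor = solve-∀
  μ·gap≡0 : μ *ᶻ (dot w p -ᶻ c) ≡ + 0
  μ·gap≡0 = trans (factor μ (dot w p) c) (trans (cong (λ t → μ *ᶻ dot w p +ᶻ t *ᶻ c) (sym Σws≡-μ)) applied)
  μ≡0 : μ ≡ + 0
  μ≡0 with ℤP.i*j≡0⇒i≡0∨j≡0 μ μ·gap≡0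
  ... | inj₁ μ≡0 = μ≡0
  ... | inj₂ gap≡0 = ⊥-elim (off-w (ℤP.i-j≡0⇒i≡j _ _ gap≡0))
  rest≡0 : lincomb P ws ≡ zeroV
  rest≡0 = trans (sym (addV-scaleV-0 p (lincomb P ws)))
                 (subst (λ t → addV (scaleV t p) (lincomb P ws) ≡ zeroV) μ≡0 lincomb≡0)

affIndepL-map-∷ : ∀ {m} c (P : List (Pt m)) → AffIndepL P → AffIndepL (map (c ∷_) P)
affIndepL-map-∷ c P indep ws len sum≡0 lincomb≡0 =
  indep ws (trans len (LP.length-map _ P)) sum≡0 (VP.∷-injectiveʳ (trans (sym (lincomb-∷ c P ws)) lincomb≡0))

nthD : ∀ {A : Set} {m} → A → Vec A m → ℕ → A
nthD d []      _       = d
nthD d (x ∷ v) zero    = x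
nthD d (x ∷ v) (suc j) = nthD d v j

nth≡nthD : ∀ {m} (x : Pt m) j → nth x j ≡ nthD (+ 0) x j
nth≡nthD []      j       = refl
nth≡nthD (a ∷ x) zero    = refl
nth≡nthD (a ∷ x) (suc j) = nth≡nthD x j

nthD-≥ : ∀ {A : Set} {m} d (v : Vec A m) j → m ≤ j → nthD d v j ≡ d
nthD-≥ d []      j       _         = refl
nthD-≥ d (x ∷ v) (suc j) (s≤s m≤j) = nthD-≥ d v j m≤j

nth-≥ : ∀ {m} (v : Pt m) j → m ≤ j → nth v j ≡ + 0
nth-≥ v j m≤j = trans (nth≡nthD v j) (nthD-≥ (+ 0) v j m≤j)

nth-∷ʳ-< : ∀ {m} (u : Pt m) h j → j < m → nth (u ∷ʳ h) j ≡ nth u j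
nth-∷ʳ-< (x ∷ u) h zero    _         = refl
nth-∷ʳ-< (x ∷ u) h (suc j) (s≤s j<m) = nth-∷ʳ-< u h j j<m

nth-∷ʳ-≡ : ∀ {m} (u : Pt m) h → nth (u ∷ʳ h) m ≡ h
nth-∷ʳ-≡ []      h = refl
nth-∷ʳ-≡ (x ∷ u) h = nth-∷ʳ-≡ u h

nth-init : ∀ {m} (x : Pt (suc m)) j → j < m → nth (V.init x) j ≡ nth x j
nth-init x j j<m with V.initLast x
... | u , h , refl = sym (nth-∷ʳ-< u h j j<m)

insAt : ∀ {A : Set} {m} → ℕ → A → Vec A m → Vec A (suc m)
insAt zero    a v       = a ∷ v
insAt (suc p) a []      = a ∷ []
insAt (suc p) a (x ∷ v) = x ∷ insAt p a v

remAt : ∀ {A : Set} {m} → ℕ → Vec A (suc m) → Vec A m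
remAt             zero    (x ∷ v) = v
remAt {m = zero}  (suc p) (x ∷ []) = []
remAt {m = suc m} (suc p) (x ∷ v) = x ∷ remAt p v

remAt-insAt : ∀ {A : Set} {m} p (a : A) (v : Vec A m) → remAt p (insAt p a v) ≡ v
remAt-insAt zero    a v       = refl
remAt-insAt (suc p) a []      = refl
remAt-insAt (suc p) a (x ∷ v) = cong (x ∷_) (remAt-insAt p a v)

insAt-remAt : ∀ {A : Set} {m} d p (a : A) (v : Vec A (suc m)) → p ≤ m → nthD d v p ≡ a → insAt p a (remAt p v) ≡ v
insAt-remAt             d zero    a (x ∷ v) _         vₚ≡a = cong (_∷ v) (sym vₚ≡a)
insAt-remAt {m = suc m} d (suc p) a (x ∷ v) (s≤s p≤m) vₚ≡a = cong (x ∷_) (insAt-remAt d p a v p≤m vₚ≡a)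

nthD-insAt-< : ∀ {A : Set} {m} d p (a : A) (v : Vec A m) j → p ≤ m → j < p → nthD d (insAt p a v) j ≡ nthD d v j
nthD-insAt-< d (suc p) a (x ∷ v) zero    _         _         = refl
nthD-insAt-< d (suc p) a (x ∷ v) (suc j) (s≤s p≤m) (s≤s j<p) = nthD-insAt-< d p a v j p≤m j<p

nthD-insAt-≡ : ∀ {A : Set} {m} d p (a : A) (v : Vec A m) → p ≤ m → nthD d (insAt p a v) p ≡ a
nthD-insAt-≡ d zero    a v       _         = refl
nthD-insAt-≡ d (suc p) a (x ∷ v) (s≤s p≤m) = nthD-insAt-≡ d p a v p≤m

nthD-insAt-> : ∀ {A : Set} {m} d p (a : A) (v : Vec A m) j → p < j → nthD d (insAt p a v) j ≡ nthD d v (j ∸ 1)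
nthD-insAt-> d zero    a v       (suc j)       _         = refl
nthD-insAt-> d (suc p) a []      (suc j)       _         = refl
nthD-insAt-> d (suc p) a (x ∷ v) (suc (suc j)) (s≤s p<j) = nthD-insAt-> d p a v (suc j) p<j

nthD-remAt-< : ∀ {A : Set} {m} d p (v : Vec A (suc m)) j → p ≤ m → j < p → nthD d (remAt p v) j ≡ nthD d v j
nthD-remAt-< {m = suc m} d (suc p) (x ∷ v) zero    _         _         = refl
nthD-remAt-< {m = suc m} d (suc p) (x ∷ v) (suc j) (s≤s p≤m) (s≤s j<p) = nthD-remAt-< d p v j p≤m j<p

nthD-remAt-≥ : ∀ {A : Set} {m} d p (v : Vec A (suc m)) j → p ≤ j → nthD d (remAt p v) j ≡ nthD d v (suc j)
nthD-remAt-≥             d zero    (x ∷ v)  j       _         = refl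
nthD-remAt-≥ {m = zero}  d (suc p) (x ∷ []) (suc j) _         = refl
nthD-remAt-≥ {m = suc m} d (suc p) (x ∷ v)  (suc j) (s≤s p≤j) = nthD-remAt-≥ d p v j p≤j

IsSelection : ∀ {a b} → (Pt a → Pt b) → (ℕ → ℕ) → Set
IsSelection {a} {b} f τ = ∀ x j → j < b → nth (f x) j ≡ nth x (τ j)

selection-lincomb : ∀ {a b} (f : Pt a → Pt b) τ → IsSelection f τ → ∀ P ws j → j < b →
  nth (lincomb (map f P) ws) j ≡ nth (lincomb P ws) (τ j)
selection-lincomb f τ sel P ws j j<b = begin
  nth (lincomb (map f P) ws) j               ≡⟨ nth-lincomb (map f P) ws j ⟩
  dotL ws (map (λ y → nth y j) (map f P))
    ≡⟨ cong (dotL ws) (trans (sym (LP.map-∘ P)) (LP.map-cong (λ x → sel x j j<b) P)) ⟩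
  dotL ws (map (λ x → nth x (τ j)) P)        ≡⟨ nth-lincomb P ws (τ j) ⟨
  nth (lincomb P ws) (τ j)                   ∎
  where open ≡-Reasoning

affIndepL-map : ∀ {a b} (f : Pt a → Pt b) (g : Pt b → Pt a) τ → IsSelection g τ → (P : List (Pt a)) →
  All (λ p → g (f p) ≡ p) P → AffIndepL P → AffIndepL (map f P)
affIndepL-map {a} {b} f g τ sel P g∘f≡id indep ws len sum≡0 lincomb≡0 =
  indep ws (trans len (LP.length-map f P)) sum≡0 (subst (λ Q → lincomb Q ws ≡ zeroV) g∘f[P]≡P g-lincomb≡0)
  where
  g∘f[P]≡P : map g (map f P) ≡ P
  g∘f[P]≡P = trans (sym (LP.map-∘ P)) (LP.map-id-local g∘f≡id)
  g-lincomb≡0 : lincomb (map g (map f P)) ws ≡ zeroV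
  g-lincomb≡0 = nth-ext _ _ λ j j<a → begin
    nth (lincomb (map g (map f P)) ws) j  ≡⟨ selection-lincomb g τ sel (map f P) ws j j<a ⟩
    nth (lincomb (map f P) ws) (τ j)      ≡⟨ cong (λ y → nth y (τ j)) lincomb≡0 ⟩
    nth (zeroV {b}) (τ j)                 ≡⟨ trans (nth-zeroV b (τ j)) (sym (nth-zeroV a j)) ⟩
    nth (zeroV {a}) j                     ∎
    where open ≡-Reasoning

selectionRows : ∀ {a} b → (ℕ → ℕ) → Vec (Pt a) b
selectionRows         zero    τ = []
selectionRows {a} (suc b) τ = unitV a (τ 0) ∷ selectionRows b (λ j → τ (suc j))

nth-applyA-selectionRows : ∀ {a} b τ (x : Pt a) j → j < b →
  nth (applyA (selectionRows b τ , zeroV) x) j ≡ nth x (τ j)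
nth-applyA-selectionRows {a} (suc b) τ x zero    _         = trans (ℤP.+-identityʳ _) (dot-unitV a (τ 0) x)
nth-applyA-selectionRows     (suc b) τ x (suc j) (s≤s j<b) = nth-applyA-selectionRows b (λ j → τ (suc j)) x j j<b

selection-affMap : ∀ {a b} (f : Pt a → Pt b) τ → IsSelection f τ → Σ (AffMap a b) λ φ → ∀ x → applyA φ x ≡ f x
selection-affMap {a} {b} f τ sel = (selectionRows b τ , zeroV) , λ x → nth-ext _ _ λ j j<b →
  trans (nth-applyA-selectionRows b τ x j j<b) (sym (sel x j j<b))

nthB : ∀ {m} → Vec Bool m → ℕ → Bool
nthB = nthD false

count : ∀ {n} → Vec Bool n → ℕ
count []          = 0
count (true ∷ v)  = suc (count v)
count (false ∷ v) = count v

<ᵇ-true : ∀ {m n} → m < n → (m <ᵇ n) ≡ true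
<ᵇ-true {m} {n} m<n with m <ᵇ n | ℕP.<⇒<ᵇ m<n
... | true | _ = refl

<ᵇ-false : ∀ {m n} → n ≤ m → (m <ᵇ n) ≡ false
<ᵇ-false {m} {n} n≤m with m <ᵇ n | ℕP.<ᵇ⇒< m n
... | true  | m<n = ⊥-elim (ℕP.<⇒≱ (m<n _) n≤m)
... | false | _   = refl

-- 0…01…1 with k ones: the lexicographically last vertex of Δ(k,n).
trailingOnes : (n k : ℕ) → Vec Bool n
trailingOnes zero    k = []
trailingOnes (suc n) k = (n <ᵇ k) ∷ trailingOnes n k

∈-combos⇒count : ∀ n k (v : Vec Bool n) → v ∈ combos n k → count v ≡ k
∈-combos⇒count zero    zero    [] _ = refl
∈-combos⇒count (suc n) zero    v  (here refl) = count-replicate n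
  where count-replicate : ∀ n → count (replicate n false) ≡ 0
        count-replicate zero    = refl
        count-replicate (suc n) = count-replicate n
∈-combos⇒count (suc n) (suc k) v v∈ with ∈-++⁻ (map (true ∷_) (combos n k)) v∈
... | inj₁ v∈₁ with ∈-map⁻ (true ∷_) v∈₁
...   | u , u∈ , refl = cong suc (∈-combos⇒count n k u u∈)
∈-combos⇒count (suc n) (suc k) v v∈ | inj₂ v∈₀ with ∈-map⁻ (false ∷_) v∈₀
...   | u , u∈ , refl = ∈-combos⇒count n (suc k) u u∈

count⇒∈-combos : ∀ n k (v : Vec Bool n) → count v ≡ k → v ∈ combos n k
count⇒∈-combos zero    zero    []          _ = here refl
count⇒∈-combos (suc n) zero    (false ∷ v) c = here (cong (false ∷_) (no-ones v c))
  where no-ones : ∀ {n} (v : Vec Bool n) → count v ≡ 0 → v ≡ replicate n false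
        no-ones []          _ = refl
        no-ones (false ∷ v) c = cong (false ∷_) (no-ones v c)
count⇒∈-combos (suc n) (suc k) (true ∷ v)  c =
  ∈-++⁺ˡ (∈-map⁺ (true ∷_) (count⇒∈-combos n k v (ℕP.suc-injective c)))
count⇒∈-combos (suc n) (suc k) (false ∷ v) c =
  ∈-++⁺ʳ (map (true ∷_) (combos n k)) (∈-map⁺ (false ∷_) (count⇒∈-combos n (suc k) v c))

length-combos : ∀ n k → length (combos n k) ≡ n C k
length-combos zero    zero    = refl
length-combos zero    (suc k) = refl
length-combos (suc n) zero    = refl
length-combos (suc n) (suc k) =
  trans (LP.length-++ (map (true ∷_) (combos n k)))
  (trans (cong₂ _+_ (trans (LP.length-map _ (combos n k)) (length-combos n k))
                    (trans (LP.length-map _ (combos n (suc k))) (length-combos n (suc k))))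
         (nCk+nC[k+1]≡[n+1]C[k+1] n k))

combos-< : ∀ n k → n < k → combos n k ≡ []
combos-< zero    (suc k) _         = refl
combos-< (suc n) (suc k) (s≤s n<k)
  rewrite combos-< n k n<k | combos-< n (suc k) (ℕP.m<n⇒m<1+n n<k) = refl

trailingOnes-zero : ∀ n → trailingOnes n 0 ≡ replicate n false
trailingOnes-zero zero    = refl
trailingOnes-zero (suc n) = cong (false ∷_) (trailingOnes-zero n)

trailingOnes-≥ : ∀ n k → n ≤ k → trailingOnes n k ≡ replicate n true
trailingOnes-≥ zero    k _   = refl
trailingOnes-≥ (suc n) k n<k = cong₂ _∷_ (<ᵇ-true n<k) (trailingOnes-≥ n k (ℕP.<⇒≤ n<k))

combos-last : ∀ n k → k ≤ n → Σ (List (Vec Bool n)) λ A → combos n k ≡ A ++ trailingOnes n k ∷ []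
combos-last zero    zero    _ = [] , refl
combos-last (suc n) zero    _ = [] , cong (_∷ []) (sym (trailingOnes-zero (suc n)))
combos-last (suc n) (suc k) (s≤s k≤n) with ℕP.m≤n⇒m<n∨m≡n k≤n
... | inj₁ k<n with combos-last n (suc k) k<n
...   | B , eq = map (true ∷_) (combos n k) ++ map (false ∷_) B , (begin
  map (true ∷_) (combos n k) ++ map (false ∷_) (combos n (suc k))
    ≡⟨ cong (λ X → map (true ∷_) (combos n k) ++ map (false ∷_) X) eq ⟩
  map (true ∷_) (combos n k) ++ map (false ∷_) (B ++ trailingOnes n (suc k) ∷ [])
    ≡⟨ cong (map (true ∷_) (combos n k) ++_) (LP.map-++ (false ∷_) B _) ⟩
  map (true ∷_) (combos n k) ++ (map (false ∷_) B ++ (false ∷ trailingOnes n (suc k)) ∷ [])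
    ≡⟨ LP.++-assoc (map (true ∷_) (combos n k)) _ _ ⟨
  (map (true ∷_) (combos n k) ++ map (false ∷_) B) ++ (false ∷ trailingOnes n (suc k)) ∷ []
    ≡⟨ cong (λ b → (map (true ∷_) (combos n k) ++ map (false ∷_) B) ++ (b ∷ trailingOnes n (suc k)) ∷ [])
            (sym (<ᵇ-false k<n)) ⟩
  (map (true ∷_) (combos n k) ++ map (false ∷_) B) ++ trailingOnes (suc n) (suc k) ∷ [] ∎)
  where open ≡-Reasoning
combos-last (suc n) (suc k) (s≤s k≤n) | inj₂ refl with combos-last k k ℕP.≤-refl
... | A , eq = map (true ∷_) A , (begin
  map (true ∷_) (combos k k) ++ map (false ∷_) (combos k (suc k))
    ≡⟨ cong₂ (λ X Y → map (true ∷_) X ++ map (false ∷_) Y) eq (combos-< k (suc k) (ℕP.n<1+n k)) ⟩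
  map (true ∷_) (A ++ trailingOnes k k ∷ []) ++ []
    ≡⟨ trans (LP.++-identityʳ _) (LP.map-++ (true ∷_) A _) ⟩
  map (true ∷_) A ++ (true ∷ trailingOnes k k) ∷ []
    ≡⟨ cong₂ (λ b u → map (true ∷_) A ++ (b ∷ u) ∷ []) (sym (<ᵇ-true (ℕP.n<1+n k)))
             (trans (trailingOnes-≥ k k ℕP.≤-refl) (sym (trailingOnes-≥ k (suc k) (ℕP.n≤1+n k)))) ⟩
  map (true ∷_) A ++ trailingOnes (suc k) (suc k) ∷ [] ∎)
  where open ≡-Reasoning

count-trailingOnes : ∀ n k → k ≤ n → count (trailingOnes n k) ≡ k
count-trailingOnes n k k≤n = ∈-combos⇒count n k (trailingOnes n k)
  (subst (trailingOnes n k ∈_) (sym (proj₂ (combos-last n k k≤n))) (∈-++⁺ʳ (proj₁ (combos-last n k k≤n)) (here refl)))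

nthB-trailingOnes : ∀ n k j → n ∸ k ≤ j → j < n → nthB (trailingOnes n k) j ≡ true
nthB-trailingOnes (suc n) k zero    n+1-k≤0 _         = <ᵇ-true (ℕP.m∸n≡0⇒m≤n {suc n} {k} (ℕP.n≤0⇒n≡0 n+1-k≤0))
nthB-trailingOnes (suc n) k (suc j) n+1-k≤j (s≤s j<n) =
  nthB-trailingOnes n k j (subst (_≤ j) (ℕP.pred[m∸n]≡m∸[1+n] (suc n) k) (ℕP.pred-mono-≤ n+1-k≤j)) j<n

count-insAt : ∀ {m} p (v : Vec Bool m) → count (insAt p false v) ≡ count v
count-insAt zero    v           = refl
count-insAt (suc p) []          = refl
count-insAt (suc p) (true ∷ v)  = cong suc (count-insAt p v)
count-insAt (suc p) (false ∷ v) = count-insAt p v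

count-remAt : ∀ {m} p (v : Vec Bool (suc m)) → p ≤ m → nthB v p ≡ false → count (remAt p v) ≡ count v
count-remAt p v p≤m vₚ≡false =
  trans (sym (count-insAt p (remAt p v))) (cong count (insAt-remAt false p false v p≤m vₚ≡false))

toℤ-insAt : ∀ {m} p (v : Vec Bool m) → toℤ (insAt p false v) ≡ insAt p (+ 0) (toℤ v)
toℤ-insAt zero    v       = refl
toℤ-insAt (suc p) []      = refl
toℤ-insAt (suc p) (b ∷ v) = cong (b2z b ∷_) (toℤ-insAt p v)

nth-toℤ : ∀ {m} (v : Vec Bool m) j → nth (toℤ v) j ≡ b2z (nthB v j)
nth-toℤ []      j       = refl
nth-toℤ (b ∷ v) zero    = refl
nth-toℤ (b ∷ v) (suc j) = nth-toℤ v j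

∈-hypersimplex : ∀ k m (v : Vec Bool m) → count v ≡ k → toℤ v ∈ hypersimplex k m
∈-hypersimplex k m v c = ∈-map⁺ toℤ (count⇒∈-combos m k v c)

hypersimplex-vertex : ∀ k m x → x ∈ hypersimplex k m → Σ (Vec Bool m) λ v → count v ≡ k × x ≡ toℤ v
hypersimplex-vertex k m x x∈ with ∈-map⁻ toℤ x∈
... | v , v∈ , x≡v = v , ∈-combos⇒count m k v v∈ , x≡v

liftFrom-++ : ∀ {n} t p (xs ys : List (Pt n)) →
  liftFrom t p (xs ++ ys) ≡ liftFrom t p xs ++ liftFrom t (p + length xs) ys
liftFrom-++ t p []       ys = cong (λ q → liftFrom t q ys) (sym (ℕP.+-identityʳ p))
liftFrom-++ t p (x ∷ xs) ys rewrite ℕP.+-suc p (length xs) with p <? t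
... | yes _ = cong (_ ∷_) (liftFrom-++ t (suc p) xs ys)
... | no  _ = cong (_ ∷_) (liftFrom-++ t (suc p) xs ys)

liftFrom-below : ∀ {n} t p (xs : List (Pt n)) → p + length xs ≤ t → liftFrom t p xs ≡ map (_∷ʳ + 1) xs
liftFrom-below t p []       _ = refl
liftFrom-below t p (x ∷ xs) p+len≤t with p <? t
... | yes _   = cong (_ ∷_) (liftFrom-below t (suc p) xs (subst (_≤ t) (ℕP.+-suc p (length xs)) p+len≤t))
... | no  p≮t = ⊥-elim (p≮t (ℕP.<-≤-trans (ℕP.m<m+n p (s≤s z≤n)) p+len≤t))

liftFrom-above : ∀ {n} t p (xs : List (Pt n)) → t ≤ p → liftFrom t p xs ≡ map (_∷ʳ + 0) xs
liftFrom-above t p []       _   = refl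
liftFrom-above t p (x ∷ xs) t≤p with p <? t
... | yes p<t = ⊥-elim (ℕP.<⇒≱ p<t t≤p)
... | no  _   = cong (_ ∷_) (liftFrom-above t (suc p) xs (ℕP.m≤n⇒m≤1+n t≤p))

-- The vertices of Δ̃(k+1, n+1), read off from the lexicographic order: all vertices with first
-- coordinate 1 are raised to height 1 except the last of them, the corner (1, 0…01…1).
module LiftedVertices (k n : ℕ) (k≤n : k ≤ n) where

  raised level : Vec Bool n → Pt (suc (suc n))
  raised v = toℤ (true ∷ v) ∷ʳ + 1
  level  v = toℤ (false ∷ v) ∷ʳ + 0

  corner : Pt (suc (suc n))
  corner = toℤ (true ∷ trailingOnes n k) ∷ʳ + 0

  private
    A B : List (Vec Bool n)
    A = proj₁ (combos-last n k k≤n)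
    B = combos n (suc k)
    X₁ X₀ : List (Pt (suc n))
    X₁ = map toℤ (map (true ∷_) A)
    X₀ = map toℤ ((true ∷ trailingOnes n k) ∷ map (false ∷_) B)

    threshold≡ : (n C k) ∸ 1 ≡ length X₁
    threshold≡ = begin
      (n C k) ∸ 1                         ≡⟨ cong (_∸ 1) (length-combos n k) ⟨
      length (combos n k) ∸ 1             ≡⟨ cong (λ X → length X ∸ 1) (proj₂ (combos-last n k k≤n)) ⟩
      length (A ++ trailingOnes n k ∷ []) ∸ 1 ≡⟨ cong (_∸ 1) (LP.length-++ A) ⟩
      length A + 1 ∸ 1                    ≡⟨ ℕP.m+n∸n≡m (length A) 1 ⟩
      length A                            ≡⟨ trans (LP.length-map _ (map (true ∷_) A)) (LP.length-map _ A) ⟨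
      length X₁                           ∎
      where open ≡-Reasoning

  decomposition : liftedHypersimplex (suc k) (suc n) ≡ map raised A ++ corner ∷ map level B
  decomposition = begin
    liftFrom ((n C k) ∸ 1) 0 (map toℤ (map (true ∷_) (combos n k) ++ map (false ∷_) B))
      ≡⟨ cong (λ Y → liftFrom ((n C k) ∸ 1) 0 (map toℤ (map (true ∷_) Y ++ map (false ∷_) B)))
              (proj₂ (combos-last n k k≤n)) ⟩
    liftFrom ((n C k) ∸ 1) 0 (map toℤ (map (true ∷_) (A ++ trailingOnes n k ∷ []) ++ map (false ∷_) B))
      ≡⟨ cong (λ Y → liftFrom ((n C k) ∸ 1) 0 (map toℤ Y))
              (trans (cong (_++ map (false ∷_) B) (LP.map-++ (true ∷_) A _)) (LP.++-assoc (map (true ∷_) A) _ _)) ⟩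
    liftFrom ((n C k) ∸ 1) 0 (map toℤ (map (true ∷_) A ++ (true ∷ trailingOnes n k) ∷ map (false ∷_) B))
      ≡⟨ cong (liftFrom ((n C k) ∸ 1) 0) (LP.map-++ toℤ (map (true ∷_) A) _) ⟩
    liftFrom ((n C k) ∸ 1) 0 (X₁ ++ X₀)
      ≡⟨ liftFrom-++ ((n C k) ∸ 1) 0 X₁ X₀ ⟩
    liftFrom ((n C k) ∸ 1) 0 X₁ ++ liftFrom ((n C k) ∸ 1) (length X₁) X₀
      ≡⟨ cong₂ _++_ (liftFrom-below _ 0 X₁ (ℕP.≤-reflexive (sym threshold≡)))
                    (liftFrom-above _ (length X₁) X₀ (ℕP.≤-reflexive threshold≡)) ⟩
    map (_∷ʳ + 1) X₁ ++ map (_∷ʳ + 0) X₀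
      ≡⟨ cong₂ _++_ (trans (sym (LP.map-∘ (map (true ∷_) A))) (sym (LP.map-∘ A)))
                    (cong (corner ∷_) (trans (sym (LP.map-∘ (map (false ∷_) B))) (sym (LP.map-∘ B)))) ⟩
    map raised A ++ corner ∷ map level B
      ∎
    where open ≡-Reasoning

  data Vertex : Pt (suc (suc n)) → Set where
    is-raised : ∀ v → count v ≡ k → Vertex (raised v)
    is-corner : Vertex corner
    is-level  : ∀ v → count v ≡ suc k → Vertex (level v)

  vertex : ∀ {x} → x ∈ liftedHypersimplex (suc k) (suc n) → Vertex x
  vertex x∈ with ∈-++⁻ (map raised A) (subst (_ ∈_) decomposition x∈)
  ... | inj₁ x∈₁ with ∈-map⁻ raised x∈₁
  ...   | v , v∈ , refl =
    is-raised v (∈-combos⇒count n k v (subst (v ∈_) (sym (proj₂ (combos-last n k k≤n))) (∈-++⁺ˡ v∈)))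
  vertex x∈ | inj₂ (here refl) = is-corner
  vertex x∈ | inj₂ (there x∈₀) with ∈-map⁻ level x∈₀
  ...   | v , v∈ , refl = is-level v (∈-combos⇒count n (suc k) v v∈)

  raised∈ : ∀ v → count v ≡ k → v ≢ trailingOnes n k → raised v ∈ liftedHypersimplex (suc k) (suc n)
  raised∈ v c v≢s with ∈-++⁻ A (subst (v ∈_) (proj₂ (combos-last n k k≤n)) (count⇒∈-combos n k v c))
  ... | inj₁ v∈A          = subst (_ ∈_) (sym decomposition) (∈-++⁺ˡ (∈-map⁺ raised v∈A))
  ... | inj₂ (here v≡s)   = ⊥-elim (v≢s v≡s)

  corner∈ : corner ∈ liftedHypersimplex (suc k) (suc n)
  corner∈ = subst (corner ∈_) (sym decomposition) (∈-++⁺ʳ (map raised A) (here refl))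

  level∈ : ∀ v → count v ≡ suc k → level v ∈ liftedHypersimplex (suc k) (suc n)
  level∈ v c = subst (_ ∈_) (sym decomposition)
    (∈-++⁺ʳ (map raised A) (there (∈-map⁺ level (count⇒∈-combos n (suc k) v c))))

0∷-∈-hypersimplex : ∀ {k m x} → x ∈ hypersimplex k m → (+ 0 ∷ x) ∈ hypersimplex k (suc m)
0∷-∈-hypersimplex {k} {m} {x} x∈ with hypersimplex-vertex k m x x∈
... | v , c , refl = ∈-hypersimplex k (suc m) (false ∷ v) c

1∷-∈-hypersimplex : ∀ {k m x} → x ∈ hypersimplex k m → (+ 1 ∷ x) ∈ hypersimplex (suc k) (suc m)
1∷-∈-hypersimplex {k} {m} {x} x∈ with hypersimplex-vertex k m x x∈
... | v , c , refl = ∈-hypersimplex (suc k) (suc m) (true ∷ v) (cong suc c)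

head-map-∷ : ∀ {m} c (L : List (Pt m)) → All (λ p → dot (unitV (suc m) 0) p ≡ c) (map (c ∷_) L)
head-map-∷ {m} c L = AllP.map⁺ (All.tabulate (λ {x} _ → dot-unitV (suc m) 0 (c ∷ x)))

-- Induction on m: add the apex (1, 0…01…1) over {x₁ = 0}, or, when k = m - 1, the apex (0, 1…1) over {x₁ = 1}.
affIndep-hypersimplex : ∀ m k → 1 ≤ k → k < m →
  Σ (List (Pt m)) λ L → length L ≡ m × All (_∈ hypersimplex k m) L × AffIndepL L
affIndep-hypersimplex (suc m) (suc k) _ (s≤s k<m) with ℕP.m≤n⇒m<n∨m≡n k<m
... | inj₁ k+1<m with affIndep-hypersimplex m (suc k) (s≤s z≤n) k+1<m
...   | L , len , L⊆ , indep =
  p ∷ map (+ 0 ∷_) L , cong suc (trans (LP.length-map _ L) len) ,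
  ∈-hypersimplex (suc k) (suc m) (true ∷ trailingOnes m k)
    (cong suc (count-trailingOnes m k (ℕP.<⇒≤ (ℕP.<-trans (ℕP.n<1+n k) k+1<m)))) ∷
    AllP.map⁺ (All.map 0∷-∈-hypersimplex L⊆) ,
  affIndepL-∷ (unitV (suc m) 0) (+ 0) p (map (+ 0 ∷_) L) (affIndepL-map-∷ (+ 0) L indep) (head-map-∷ (+ 0) L)
    (λ p₀≡0 → case trans (sym (dot-unitV (suc m) 0 p)) p₀≡0 of λ ())
  where
  p : Pt (suc m)
  p = toℤ (true ∷ trailingOnes m k)
affIndep-hypersimplex (suc m) (suc zero) _ (s≤s k<m) | inj₂ refl =
  p ∷ q ∷ [] , refl ,
  ∈-hypersimplex 1 2 (false ∷ true ∷ []) refl ∷ ∈-hypersimplex 1 2 (true ∷ false ∷ []) refl ∷ [] ,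
  affIndepL-∷ (unitV 2 0) (+ 1) p (q ∷ []) affIndepL-[ q ] (refl ∷ []) (λ ())
  where
  p q : Pt 2
  p = + 0 ∷ + 1 ∷ []
  q = + 1 ∷ + 0 ∷ []
affIndep-hypersimplex (suc m) (suc (suc k)) _ (s≤s k<m) | inj₂ refl
  with affIndep-hypersimplex (suc (suc k)) (suc k) (s≤s z≤n) (ℕP.n<1+n _)
... | L , len , L⊆ , indep =
  p ∷ map (+ 1 ∷_) L , cong suc (trans (LP.length-map _ L) len) ,
  ∈-hypersimplex (suc (suc k)) (suc (suc (suc k))) (false ∷ trailingOnes _ _) (count-trailingOnes _ _ ℕP.≤-refl) ∷
    AllP.map⁺ (All.map 1∷-∈-hypersimplex L⊆) ,
  affIndepL-∷ (unitV (suc (suc (suc k))) 0) (+ 1) p (map (+ 1 ∷_) L) (affIndepL-map-∷ (+ 1) L indep) (head-map-∷ (+ 1) L)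
    (λ p₀≡1 → case trans (sym (dot-unitV (suc (suc (suc k))) 0 p)) p₀≡1 of λ ())
  where
  p : Pt (suc (suc (suc k)))
  p = toℤ (false ∷ trailingOnes (suc (suc k)) (suc (suc k)))

b2z≡0 : ∀ {b} → b2z b ≡ + 0 → b ≡ false
b2z≡0 {false} _ = refl

b2z≥0 : ∀ b → + 0 ≤ℤ b2z b
b2z≥0 true  = +≤+ z≤n
b2z≥0 false = +≤+ z≤n

dot-ones : ∀ {m} (v : Vec Bool m) → dot (replicate m (+ 1)) (toℤ v) ≡ + count v
dot-ones []          = refl
dot-ones (true ∷ v)  rewrite dot-ones v = refl
dot-ones (false ∷ v) rewrite dot-ones v = ℤP.+-identityˡ _

-- A linear dependence among points on an affine hyperplane missing the origin is an affine dependence.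
dependent⇒¬affIndep : ∀ {m} (w : Pt (suc m)) → V.head w ≢ + 0 → (L : List (Pt m)) →
  All (λ x → dot w (+ 1 ∷ x) ≡ + 0) L → Dependent L → ¬ AffIndep L
dependent⇒¬affIndep w w₀≢0 L on-w dep = dependent-homogenised⇒¬affIndep L
  (dependent-from-tails w w₀≢0 (map (+ 1 ∷_) L) (AllP.map⁺ on-w)
    (subst Dependent (sym (trans (sym (LP.map-∘ L)) (LP.map-id L))) dep))

IsPyramidalLowerFacet : (k n i : ℕ) → Set
IsPyramidalLowerFacet k n i =
  All (λ x → + 0 ≤ℤ gfun n i x) (liftedHypersimplex k n) ×
  IsLowerFacet (liftedHypersimplex k n) (zeroSet k n i) ×
  IsoToPyramidOver (zeroSet k n i) (hypersimplex k (n ∸ 1))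

SameFace : (k n i j : ℕ) → Set
SameFace k n i j = All (_∈ zeroSet k n j) (zeroSet k n i) × All (_∈ zeroSet k n i) (zeroSet k n j)

-- With K = suc k, N = suc (suc n), I = suc (suc i) the paper's parameters, a vertex of Δ̃(K,N) is (b, v, h)
-- with v : Vec Bool (suc n), and g_I (b, v, h) = - b + v[i] + h.
module LowerFacet (k n i : ℕ) (k<n : k < n) (i≥ : suc n ∸ k ≤ i) (i≤n : i ≤ n) where

  open LiftedVertices k (suc n) (ℕP.<⇒≤ (ℕP.m<n⇒m<1+n k<n)) public

  P F : List (Pt (suc (suc (suc n))))
  P = liftedHypersimplex (suc k) (suc (suc n))
  F = zeroSet (suc k) (suc (suc n)) (suc (suc i))

  Q : List (Pt (suc n))
  Q = hypersimplex (suc k) (suc n)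

  g : Pt (suc (suc (suc n))) → ℤ
  g = gfun (suc (suc n)) (suc (suc i))

  i<n+1 : i < suc n
  i<n+1 = s≤s i≤n

  corner-i : nthB (trailingOnes (suc n) k) i ≡ true
  corner-i = nthB-trailingOnes (suc n) k i i≥ i<n+1

  g-vertex : ∀ b (v : Vec Bool (suc n)) h → g (toℤ (b ∷ v) ∷ʳ h) ≡ (- b2z b) +ᶻ b2z (nthB v i) +ᶻ h
  g-vertex b v h = cong₂ (λ u w → (- b2z b) +ᶻ u +ᶻ w)
    (trans (nth-∷ʳ-< (toℤ v) h i i<n+1) (nth-toℤ v i)) (nth-∷ʳ-≡ (toℤ v) h)

  g-diagonal : ∀ b v → g (toℤ (b ∷ v) ∷ʳ b2z b) ≡ b2z (nthB v i)
  g-diagonal b v = trans (g-vertex b v (b2z b)) (cancel (b2z b) (b2z (nthB v i)))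
    where cancel : ∀ b c → (- b) +ᶻ c +ᶻ b ≡ c
          cancel = solve-∀

  g-corner : g corner ≡ + 0
  g-corner = trans (g-vertex true (trailingOnes (suc n) k) (+ 0)) (cong (λ b → (- + 1) +ᶻ b2z b +ᶻ + 0) corner-i)

  g≥0 : ∀ {x} → x ∈ P → + 0 ≤ℤ g x
  g≥0 x∈ with vertex x∈
  ... | is-raised v _ = subst (+ 0 ≤ℤ_) (sym (g-diagonal true v)) (b2z≥0 (nthB v i))
  ... | is-corner     = subst (+ 0 ≤ℤ_) (sym g-corner) (+≤+ z≤n)
  ... | is-level v _  = subst (+ 0 ≤ℤ_) (sym (g-diagonal false v)) (b2z≥0 (nthB v i))

  ∈F : ∀ {x} → x ∈ P → g x ≡ + 0 → x ∈ F
  ∈F x∈P gx≡0 = ∈-filter⁺ (λ x → g x ℤ.≟ + 0) x∈P gx≡0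

  F⊆ : ∀ {x} → x ∈ F → x ∈ P × g x ≡ + 0
  F⊆ = ∈-filter⁻ (λ x → g x ℤ.≟ + 0)

  e : ℕ → Pt (suc (suc (suc n)))
  e = unitV (suc (suc (suc n)))

  gNormal : Pt (suc (suc (suc n)))
  gNormal = addV (scaleV (- + 1) (e 0)) (addV (e (suc i)) (e (suc (suc n))))

  dot-gNormal : ∀ x → dot gNormal x ≡ g x
  dot-gNormal x = begin
    dot gNormal x
      ≡⟨ dot-addVˡ (scaleV (- + 1) (e 0)) (addV (e (suc i)) (e (suc (suc n)))) x ⟩
    dot (scaleV (- + 1) (e 0)) x +ᶻ dot (addV (e (suc i)) (e (suc (suc n)))) x
      ≡⟨ cong₂ _+ᶻ_ (dot-scaleVˡ (- + 1) (e 0) x) (dot-addVˡ (e (suc i)) (e (suc (suc n))) x) ⟩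
    (- + 1) *ᶻ dot (e 0) x +ᶻ (dot (e (suc i)) x +ᶻ dot (e (suc (suc n))) x)
      ≡⟨ cong₂ (λ a b → (- + 1) *ᶻ a +ᶻ b) (dot-unitV (suc (suc (suc n))) 0 x)
               (cong₂ _+ᶻ_ (dot-unitV (suc (suc (suc n))) (suc i) x) (dot-unitV (suc (suc (suc n))) (suc (suc n)) x)) ⟩
    (- + 1) *ᶻ nth x 0 +ᶻ (nth x (suc i) +ᶻ nth x (suc (suc n)))
      ≡⟨ regroup (nth x 0) (nth x (suc i)) (nth x (suc (suc n))) ⟩
    g x ∎
    where
    open ≡-Reasoning
    regroup : ∀ a b c → (- + 1) *ᶻ a +ᶻ (b +ᶻ c) ≡ (- a) +ᶻ b +ᶻ c
    regroup = solve-∀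

  outerNormal : Pt (suc (suc (suc n)))
  outerNormal = scaleV (- + 1) gNormal

  dot-outerNormal : ∀ x → dot outerNormal x ≡ - g x
  dot-outerNormal x = trans (dot-scaleVˡ (- + 1) gNormal x) (trans (cong ((- + 1) *ᶻ_) (dot-gNormal x)) (ℤP.-1*i≡-i (g x)))

  outerNormal-last : nth outerNormal (suc (suc n)) ≡ -[1+ 0 ]
  outerNormal-last = begin
    nth outerNormal (suc (suc n))
      ≡⟨ nth-scaleV (- + 1) gNormal (suc (suc n)) ⟩
    (- + 1) *ᶻ nth gNormal (suc (suc n))
      ≡⟨ cong ((- + 1) *ᶻ_) (trans (nth-addV (scaleV (- + 1) (e 0)) (addV (e (suc i)) (e (suc (suc n)))) (suc (suc n)))
           (cong₂ _+ᶻ_ (nth-scaleV (- + 1) (e 0) (suc (suc n)))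
                       (nth-addV (e (suc i)) (e (suc (suc n))) (suc (suc n))))) ⟩
    (- + 1) *ᶻ ((- + 1) *ᶻ nth (e 0) (suc (suc n))
                +ᶻ (nth (e (suc i)) (suc (suc n)) +ᶻ nth (e (suc (suc n))) (suc (suc n))))
      ≡⟨ cong₂ (λ a b → (- + 1) *ᶻ ((- + 1) *ᶻ a +ᶻ b))
               (nth-unitV-≢ (suc (suc (suc n))) 0 (suc (suc n)) (λ ()))
               (cong₂ _+ᶻ_ (nth-unitV-≢ (suc (suc (suc n))) (suc i) (suc (suc n))
                                         (λ i+1≡n+2 → ℕP.<⇒≢ i<n+1 (ℕP.suc-injective i+1≡n+2)))
                           (nth-unitV-≡ (suc (suc (suc n))) (suc (suc n)) (ℕP.n<1+n _))) ⟩
    -[1+ 0 ] ∎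
    where open ≡-Reasoning

  isLowerFace : IsLowerFace P F
  isLowerFace = outerNormal , + 0 ,
    All.tabulate (λ {x} x∈P → subst (_≤ℤ + 0) (sym (dot-outerNormal x)) (ℤP.neg-mono-≤ (g≥0 x∈P))) ,
    All.tabulate (λ {x} x∈ → let x∈P , cx≡0 = ∈-filter⁻ (λ x → dot outerNormal x ℤ.≟ + 0) {xs = P} x∈
                              in ∈F x∈P (ℤP.neg-injective (trans (sym (dot-outerNormal x)) cx≡0))) ,
    All.tabulate (λ {x} x∈F → proj₁ (F⊆ x∈F) , trans (dot-outerNormal x) (cong -_ (proj₂ (F⊆ x∈F)))) ,
    subst (_<ℤ + 0) (sym outerNormal-last) -<+

  -- On the vertices of the facet other than the corner, x_I = 0 and the height equals x_1;
  -- ψ puts back exactly these two coordinates.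
  ψ : Pt (suc n) → Pt (suc (suc (suc n)))
  ψ y = insAt (suc i) (+ 0) y ∷ʳ nth y 0

  φ : Pt (suc (suc (suc n))) → Pt (suc n)
  φ x = remAt (suc i) (V.init x)

  φ∘ψ : ∀ y → φ (ψ y) ≡ y
  φ∘ψ y = trans (cong (remAt (suc i)) (VP.init-∷ʳ (nth y 0) (insAt (suc i) (+ 0) y))) (remAt-insAt (suc i) (+ 0) y)

  ψ-toℤ : ∀ b (w : Vec Bool n) → ψ (toℤ (b ∷ w)) ≡ toℤ (b ∷ insAt i false w) ∷ʳ b2z b
  ψ-toℤ b w = cong (λ u → (b2z b ∷ u) ∷ʳ b2z b) (sym (toℤ-insAt i w))

  τφ : ℕ → ℕ
  τφ j = if j <ᵇ suc i then j else suc j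

  φ-selection : IsSelection φ τφ
  φ-selection x j j<n+1 with j <? suc i
  ... | yes j≤i rewrite <ᵇ-true j≤i = begin
    nth (remAt (suc i) (V.init x)) j          ≡⟨ nth≡nthD (remAt (suc i) (V.init x)) j ⟩
    nthD (+ 0) (remAt (suc i) (V.init x)) j   ≡⟨ nthD-remAt-< (+ 0) (suc i) (V.init x) j i<n+1 j≤i ⟩
    nthD (+ 0) (V.init x) j                   ≡⟨ nth≡nthD (V.init x) j ⟨
    nth (V.init x) j                          ≡⟨ nth-init x j (ℕP.m<n⇒m<1+n j<n+1) ⟩
    nth x j                                   ∎
    where open ≡-Reasoning
  ... | no j≰i rewrite <ᵇ-false (ℕP.≮⇒≥ j≰i) = begin
    nth (remAt (suc i) (V.init x)) j          ≡⟨ nth≡nthD (remAt (suc i) (V.init x)) j ⟩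
    nthD (+ 0) (remAt (suc i) (V.init x)) j   ≡⟨ nthD-remAt-≥ (+ 0) (suc i) (V.init x) j (ℕP.≮⇒≥ j≰i) ⟩
    nthD (+ 0) (V.init x) (suc j)             ≡⟨ nth≡nthD (V.init x) (suc j) ⟨
    nth (V.init x) (suc j)                    ≡⟨ nth-init x (suc j) (s≤s j<n+1) ⟩
    nth x (suc j)                             ∎
    where open ≡-Reasoning

  -- Index suc n is out of range for y, so its junk value 0 supplies the inserted coordinate.
  τψ : ℕ → ℕ
  τψ j = if j <ᵇ suc i then j else if j <ᵇ suc (suc i) then suc n else if j <ᵇ suc (suc n) then j ∸ 1 else 0

  ψ-selection : IsSelection ψ τψ
  ψ-selection y j j<n+3 with j <? suc i
  ... | yes j≤i rewrite <ᵇ-true j≤i = begin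
    nth (ψ y) j                               ≡⟨ nth-∷ʳ-< (insAt (suc i) (+ 0) y) (nth y 0) j (ℕP.<-trans j≤i (s≤s i<n+1)) ⟩
    nth (insAt (suc i) (+ 0) y) j             ≡⟨ nth≡nthD (insAt (suc i) (+ 0) y) j ⟩
    nthD (+ 0) (insAt (suc i) (+ 0) y) j      ≡⟨ nthD-insAt-< (+ 0) (suc i) (+ 0) y j i<n+1 j≤i ⟩
    nthD (+ 0) y j                            ≡⟨ nth≡nthD y j ⟨
    nth y j                                   ∎
    where open ≡-Reasoning
  ... | no j≰i rewrite <ᵇ-false (ℕP.≮⇒≥ j≰i) with j <? suc (suc i)
  ...   | yes j≤i+1 rewrite <ᵇ-true j≤i+1 | ℕP.≤-antisym (ℕP.≤-pred j≤i+1) (ℕP.≮⇒≥ j≰i) = begin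
    nth (ψ y) (suc i)                         ≡⟨ nth-∷ʳ-< (insAt (suc i) (+ 0) y) (nth y 0) (suc i) (s≤s i<n+1) ⟩
    nth (insAt (suc i) (+ 0) y) (suc i)       ≡⟨ nth≡nthD (insAt (suc i) (+ 0) y) (suc i) ⟩
    nthD (+ 0) (insAt (suc i) (+ 0) y) (suc i) ≡⟨ nthD-insAt-≡ (+ 0) (suc i) (+ 0) y i<n+1 ⟩
    + 0                                       ≡⟨ nth-≥ y (suc n) ℕP.≤-refl ⟨
    nth y (suc n)                             ∎
    where open ≡-Reasoning
  ...   | no j≰i+1 rewrite <ᵇ-false (ℕP.≮⇒≥ j≰i+1) with j <? suc (suc n)
  ...     | yes j<n+2 rewrite <ᵇ-true j<n+2 = begin
    nth (ψ y) j                               ≡⟨ nth-∷ʳ-< (insAt (suc i) (+ 0) y) (nth y 0) j j<n+2 ⟩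
    nth (insAt (suc i) (+ 0) y) j             ≡⟨ nth≡nthD (insAt (suc i) (+ 0) y) j ⟩
    nthD (+ 0) (insAt (suc i) (+ 0) y) j      ≡⟨ nthD-insAt-> (+ 0) (suc i) (+ 0) y j (ℕP.≮⇒≥ j≰i+1) ⟩
    nthD (+ 0) y (j ∸ 1)                      ≡⟨ nth≡nthD y (j ∸ 1) ⟨
    nth y (j ∸ 1)                             ∎
    where open ≡-Reasoning
  ...     | no j≮n+2 rewrite <ᵇ-false (ℕP.≮⇒≥ j≮n+2) | ℕP.≤-antisym (ℕP.≤-pred j<n+3) (ℕP.≮⇒≥ j≮n+2) =
    nth-∷ʳ-≡ (insAt (suc i) (+ 0) y) (nth y 0)

  Q′ : List (Pt (suc (suc (suc n))))
  Q′ = map ψ Q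

  corner∈F : corner ∈ F
  corner∈F = ∈F corner∈ g-corner

  ψ-vertex∈F : ∀ b (w : Vec Bool n) → count (b ∷ w) ≡ suc k → ψ (toℤ (b ∷ w)) ∈ F
  ψ-vertex∈F b w c = subst (_∈ F) (sym (ψ-toℤ b w)) (∈F (vertex∈ b c) (trans (g-diagonal b v) (cong b2z vᵢ≡false)))
    where
    v = insAt i false w
    vᵢ≡false : nthB v i ≡ false
    vᵢ≡false = nthD-insAt-≡ false i false w i≤n
    vertex∈ : ∀ b → count (b ∷ w) ≡ suc k → toℤ (b ∷ v) ∷ʳ b2z b ∈ P
    vertex∈ true  c = raised∈ v (trans (count-insAt i w) (ℕP.suc-injective c))
                        (λ v≡s → case trans (sym vᵢ≡false) (trans (cong (λ u → nthB u i) v≡s) corner-i) of λ ())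
    vertex∈ false c = level∈ v (trans (count-insAt i w) c)

  ψ[Q]⊆F : ∀ {q} → q ∈ Q → ψ q ∈ F
  ψ[Q]⊆F {q} q∈Q with hypersimplex-vertex (suc k) (suc n) q q∈Q
  ... | b ∷ w , c , refl = ψ-vertex∈F b w c

  diagonal∈Q′ : ∀ b v → count (b ∷ v) ≡ suc k → nthB v i ≡ false → toℤ (b ∷ v) ∷ʳ b2z b ∈ Q′
  diagonal∈Q′ b v c vᵢ≡false =
    subst (_∈ Q′) ψ[w]≡x (∈-map⁺ ψ (∈-hypersimplex (suc k) (suc n) (b ∷ remAt i v) c′))
    where
    c′ : count (b ∷ remAt i v) ≡ suc k
    c′ = trans (count-remAt (suc i) (b ∷ v) i<n+1 vᵢ≡false) c
    ψ[w]≡x : ψ (toℤ (b ∷ remAt i v)) ≡ toℤ (b ∷ v) ∷ʳ b2z b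
    ψ[w]≡x = trans (ψ-toℤ b (remAt i v))
                   (cong (λ u → toℤ (b ∷ u) ∷ʳ b2z b) (insAt-remAt false i false v i≤n vᵢ≡false))

  F⊆pyramid : ∀ {x} → x ∈ F → x ∈ corner ∷ Q′
  F⊆pyramid x∈F with F⊆ x∈F
  ... | x∈P , gx≡0 with vertex x∈P
  ...   | is-raised v c = there (diagonal∈Q′ true v (cong suc c) (b2z≡0 (trans (sym (g-diagonal true v)) gx≡0)))
  ...   | is-corner     = here refl
  ...   | is-level v c  = there (diagonal∈Q′ false v c (b2z≡0 (trans (sym (g-diagonal false v)) gx≡0)))

  pyramid⊆F : ∀ {x} → x ∈ corner ∷ Q′ → x ∈ F
  pyramid⊆F (here refl) = corner∈F
  pyramid⊆F (there x∈Q′) with ∈-map⁻ ψ x∈Q′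
  ... | q , q∈Q , refl = ψ[Q]⊆F q∈Q

  ℓ : Pt (suc (suc (suc n)))
  ℓ = e (suc i)

  ℓ∘ψ≡0 : ∀ y → dot ℓ (ψ y) ≡ + 0
  ℓ∘ψ≡0 y = begin
    dot ℓ (ψ y)                               ≡⟨ dot-unitV (suc (suc (suc n))) (suc i) (ψ y) ⟩
    nth (ψ y) (suc i)                         ≡⟨ nth-∷ʳ-< (insAt (suc i) (+ 0) y) (nth y 0) (suc i) (s≤s i<n+1) ⟩
    nth (insAt (suc i) (+ 0) y) (suc i)       ≡⟨ nth≡nthD (insAt (suc i) (+ 0) y) (suc i) ⟩
    nthD (+ 0) (insAt (suc i) (+ 0) y) (suc i) ≡⟨ nthD-insAt-≡ (+ 0) (suc i) (+ 0) y i<n+1 ⟩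
    + 0                                       ∎
    where open ≡-Reasoning

  ℓ-corner : dot ℓ corner ≡ + 1
  ℓ-corner = trans (dot-unitV (suc (suc (suc n))) (suc i) corner)
    (trans (nth-∷ʳ-< (toℤ (trailingOnes (suc n) k)) (+ 0) i i<n+1)
    (trans (nth-toℤ (trailingOnes (suc n) k) i) (cong b2z corner-i)))

  pyramid-height : LatticeDistOne corner Q′
  pyramid-height = ℓ , + 0 ,
    AllP.map⁺ (All.tabulate (λ {y} _ → trans (ℤP.+-identityʳ _) (ℓ∘ψ≡0 y))) ,
    trans (ℤP.+-identityʳ _) ℓ-corner

  Q′≅Q : LatticeIso Q′ Q
  Q′≅Q with selection-affMap φ τφ φ-selection | selection-affMap ψ τψ ψ-selection
  ... | Φ , Φ≡φ | Ψ , Ψ≡ψ = Φ , Ψ ,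
    AllP.map⁺ (All.tabulate (λ {q} q∈Q → subst (_∈ Q) (sym (Φ∘ψ q)) q∈Q)) ,
    All.tabulate (λ {q} q∈Q → subst (_∈ Q′) (sym (Ψ≡ψ q)) (∈-map⁺ ψ q∈Q)) ,
    AllP.map⁺ (All.tabulate (λ {q} _ → trans (cong (applyA Ψ) (Φ∘ψ q)) (Ψ≡ψ q))) ,
    All.tabulate (λ {q} _ → trans (cong (applyA Φ) (Ψ≡ψ q)) (Φ∘ψ q))
    where
    Φ∘ψ : ∀ q → applyA Φ (ψ q) ≡ q
    Φ∘ψ q = trans (Φ≡φ (ψ q)) (φ∘ψ q)

  F≅pyramid : LatticeIso F (corner ∷ Q′)
  F≅pyramid with selection-affMap {suc (suc (suc n))} (λ x → x) (λ j → j) (λ _ _ _ → refl)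
  ... | Id , Id≡id = Id , Id ,
    All.tabulate (λ {x} x∈F → subst (_∈ corner ∷ Q′) (sym (Id≡id x)) (F⊆pyramid x∈F)) ,
    All.tabulate (λ {x} x∈ → subst (_∈ F) (sym (Id≡id x)) (pyramid⊆F x∈)) ,
    All.tabulate (λ {x} _ → trans (cong (applyA Id) (Id≡id x)) (Id≡id x)) ,
    All.tabulate (λ {x} _ → trans (cong (applyA Id) (Id≡id x)) (Id≡id x))

  isoToPyramid : IsoToPyramidOver F Q
  isoToPyramid = suc (suc (suc n)) , Q′ , corner , Q′≅Q , pyramid-height , F≅pyramid

  -- w₁ · (1, x) = Σ_{j ≤ N} x_j - K, which vanishes on every vertex.
  w₁ : Pt (suc (suc (suc (suc n))))
  w₁ = - + suc k ∷ (replicate (suc (suc n)) (+ 1) ∷ʳ + 0)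

  vertex-on-w₁ : ∀ u h → count u ≡ suc k → dot w₁ (+ 1 ∷ (toℤ u ∷ʳ h)) ≡ + 0
  vertex-on-w₁ u h c rewrite dot-∷ʳ (replicate (suc (suc n)) (+ 1)) (toℤ u) (+ 0) h | dot-ones u | c =
    cancel (+ suc k) h
    where cancel : ∀ K h → (- K) *ᶻ + 1 +ᶻ (K +ᶻ + 0 *ᶻ h) ≡ + 0
          cancel = solve-∀

  on-w₁ : ∀ {x} → x ∈ P → dot w₁ (+ 1 ∷ x) ≡ + 0
  on-w₁ x∈P with vertex x∈P
  ... | is-raised v c = vertex-on-w₁ (true ∷ v) (+ 1) (cong suc c)
  ... | is-corner     = vertex-on-w₁ (true ∷ trailingOnes (suc n) k) (+ 0)
                          (cong suc (count-trailingOnes (suc n) k (ℕP.<⇒≤ (ℕP.m<n⇒m<1+n k<n))))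
  ... | is-level v c  = vertex-on-w₁ (false ∷ v) (+ 0) c

  ¬affIndep-P : ∀ L → All (_∈ P) L → Dependent L → ¬ AffIndep L
  ¬affIndep-P L L⊆P = dependent⇒¬affIndep w₁ (λ ()) L (All.map on-w₁ L⊆P)

  dim-P-upper : ¬ HasAffIndep P (suc (suc (suc (suc n))))
  dim-P-upper (L , len , L⊆P , indep) =
    ¬affIndep-P L L⊆P (dim<length⇒dependent _ L (ℕP.≤-reflexive (sym len))) indep

  dim-F-upper : ¬ HasAffIndep F (suc (suc (suc n)))
  dim-F-upper (L , len , L⊆F , indep) = ¬affIndep-P L (All.map (proj₁ ∘ F⊆) L⊆F) dependent indep
    where
    dependent : Dependent L
    dependent = dependent-from-tails gNormal (λ ()) L (All.map (λ {x} x∈F → trans (dot-gNormal x) (proj₂ (F⊆ x∈F))) L⊆F)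
      (dim<length⇒dependent _ (map V.tail L) (ℕP.≤-reflexive (sym (trans (LP.length-map V.tail L) len))))

  private
    base : Σ (List (Pt (suc n))) λ L → length L ≡ suc n × All (_∈ Q) L × AffIndepL L
    base = affIndep-hypersimplex (suc n) (suc k) (s≤s z≤n) (s≤s k<n)
    L₀ : List (Pt (suc n))
    L₀ = proj₁ base

  facetSpan : List (Pt (suc (suc (suc n))))
  facetSpan = corner ∷ map ψ L₀

  facetSpan⊆F : All (_∈ F) facetSpan
  facetSpan⊆F = corner∈F ∷ AllP.map⁺ (All.map ψ[Q]⊆F (proj₁ (proj₂ (proj₂ base))))

  facetSpan-indep : AffIndepL facetSpan
  facetSpan-indep = affIndepL-∷ ℓ (+ 0) corner (map ψ L₀)
    (affIndepL-map ψ φ τφ φ-selection L₀ (All.tabulate (λ {y} _ → φ∘ψ y)) (proj₂ (proj₂ (proj₂ base))))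
    (AllP.map⁺ (All.tabulate (λ {y} _ → ℓ∘ψ≡0 y)))
    (λ ℓ-corner≡0 → case trans (sym ℓ-corner) ℓ-corner≡0 of λ ())

  dim-F-lower : HasAffIndep F (suc (suc n))
  dim-F-lower = facetSpan , cong suc (trans (LP.length-map ψ L₀) (proj₁ (proj₂ base))) ,
                facetSpan⊆F , affIndepL⇒affIndep facetSpan facetSpan-indep

  far : Pt (suc (suc (suc n)))
  far = level (trailingOnes (suc n) (suc k))

  g-far : g far ≡ + 1
  g-far = trans (g-diagonal false (trailingOnes (suc n) (suc k)))
    (cong b2z (nthB-trailingOnes (suc n) (suc k) i (ℕP.≤-trans (ℕP.∸-monoʳ-≤ (suc n) (ℕP.n≤1+n k)) i≥) i<n+1))

  dim-P-lower : HasAffIndep P (suc (suc (suc n)))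
  dim-P-lower = far ∷ facetSpan , cong (suc ∘ suc) (trans (LP.length-map ψ L₀) (proj₁ (proj₂ base))) ,
    level∈ (trailingOnes (suc n) (suc k)) (count-trailingOnes (suc n) (suc k) (s≤s (ℕP.<⇒≤ k<n))) ∷
      All.map (proj₁ ∘ F⊆) facetSpan⊆F ,
    affIndepL⇒affIndep (far ∷ facetSpan)
      (affIndepL-∷ gNormal (+ 0) far facetSpan facetSpan-indep
        (All.map (λ {x} x∈F → trans (dot-gNormal x) (proj₂ (F⊆ x∈F))) facetSpan⊆F)
        (λ far≡0 → case trans (sym (trans (dot-gNormal far) g-far)) far≡0 of λ ()))

  isLowerFacet : IsLowerFacet P F
  isLowerFacet = isLowerFace , suc n , (dim-F-lower , dim-F-upper) , (dim-P-lower , dim-P-upper)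

  facet : IsPyramidalLowerFacet (suc k) (suc (suc n)) (suc (suc i))
  facet = All.tabulate g≥0 , isLowerFacet , isoToPyramid

module DistinctFacets (k n i j : ℕ) (k<n : k < n) (i≥ : suc n ∸ k ≤ i) (i≤n : i ≤ n)
                      (j≥ : suc n ∸ k ≤ j) (j≤n : j ≤ n) (i≢j : i ≢ j) where

  module Fᵢ = LowerFacet k n i k<n i≥ i≤n
  module Fⱼ = LowerFacet k n j k<n j≥ j≤n

  -- A level vertex with v[j] = 0 and v[i] = 1: on the facet of g_J but not on that of g_I.
  v : Vec Bool (suc n)
  v = insAt j false (trailingOnes n (suc k))

  n-k-1≤i : n ∸ suc k ≤ i
  n-k-1≤i = ℕP.≤-trans (ℕP.∸-monoʳ-≤ n (ℕP.n≤1+n k)) (ℕP.≤-trans (ℕP.∸-monoˡ-≤ k (ℕP.n≤1+n n)) i≥)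

  vᵢ≡true : nthB v i ≡ true
  vᵢ≡true with ℕP.<-cmp i j
  ... | tri< i<j _ _ = trans (nthD-insAt-< false j false _ i j≤n i<j)
                             (nthB-trailingOnes n (suc k) i n-k-1≤i (ℕP.<-≤-trans i<j j≤n))
  ... | tri≈ _ i≡j _ = ⊥-elim (i≢j i≡j)
  ... | tri> _ _ j<i = trans (nthD-insAt-> false j false _ i j<i)
                             (nthB-trailingOnes n (suc k) (i ∸ 1) n-k-1≤i-1 (pred-< j<i i≤n))
    where
    n-k-1≤i-1 : n ∸ suc k ≤ i ∸ 1
    n-k-1≤i-1 = ℕP.≤-trans (ℕP.∸-monoʳ-≤ n (ℕP.n≤1+n k))
      (ℕP.≤-trans (ℕP.≤-reflexive (sym (trans (ℕP.∸-+-assoc (suc n) k 1) (cong (suc n ∸_) (ℕP.+-comm k 1)))))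
                  (ℕP.∸-monoˡ-≤ 1 i≥))
    pred-< : ∀ {a b m} → b < a → a ≤ m → a ∸ 1 < m
    pred-< {suc a} _ a+1≤m = a+1≤m

  v∈Fⱼ : Fⱼ.level v ∈ Fⱼ.F
  v∈Fⱼ = Fⱼ.∈F (Fⱼ.level∈ v (trans (count-insAt j _) (count-trailingOnes n (suc k) k<n)))
               (trans (Fⱼ.g-diagonal false v) (cong b2z (nthD-insAt-≡ false j false _ j≤n)))

  distinct : ¬ SameFace (suc k) (suc (suc n)) (suc (suc i)) (suc (suc j))
  distinct (_ , Fⱼ⊆Fᵢ) with trans (sym (Fᵢ.g-diagonal false v)) (proj₂ (Fᵢ.F⊆ (All.lookup Fⱼ⊆Fᵢ v∈Fⱼ)))
  ... | b2z[vᵢ]≡0 rewrite vᵢ≡true = case b2z[vᵢ]≡0 of λ ()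

+2≤⇒≡suc-suc : ∀ m i → m + 2 ≤ i → Σ ℕ λ i′ → i ≡ suc (suc i′) × m ≤ i′
+2≤⇒≡suc-suc m i m+2≤i with subst (_≤ i) (ℕP.+-comm m 2) m+2≤i
... | s≤s (s≤s m≤i′) = _ , refl , m≤i′

lemma4p8 : (k n : ℕ) → 2 ≤ k → k + 2 ≤ n →
    ((i : ℕ) → n ∸ k + 2 ≤ i → i ≤ n →
      All (λ x → + 0 ≤ℤ gfun n i x) (liftedHypersimplex k n) ×
      IsLowerFacet (liftedHypersimplex k n) (zeroSet k n i) ×
      IsoToPyramidOver (zeroSet k n i) (hypersimplex k (n ∸ 1))) ×
    ((i j : ℕ) → n ∸ k + 2 ≤ i → i ≤ n → n ∸ k + 2 ≤ j → j ≤ n → i ≢ j →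
      ¬ (All (_∈ zeroSet k n j) (zeroSet k n i) × All (_∈ zeroSet k n i) (zeroSet k n j)))
-- For k = 1 the range of i is empty, so 2 ≤ k is only needed to exclude k = 0.
lemma4p8 zero    n       ()   _
lemma4p8 (suc k) n       _    k+2≤n with +2≤⇒≡suc-suc (suc k) n k+2≤n
... | n′ , refl , k<n′ = facets , distinct
  where
  facets : ∀ i → suc n′ ∸ k + 2 ≤ i → i ≤ suc (suc n′) → IsPyramidalLowerFacet (suc k) (suc (suc n′)) i
  facets i i≥ i≤n with +2≤⇒≡suc-suc (suc n′ ∸ k) i i≥
  ... | i′ , refl , i′≥ = LowerFacet.facet k n′ i′ k<n′ i′≥ (ℕP.≤-pred (ℕP.≤-pred i≤n))
  distinct : ∀ i j → suc n′ ∸ k + 2 ≤ i → i ≤ suc (suc n′) → suc n′ ∸ k + 2 ≤ j → j ≤ suc (suc n′) → i ≢ j →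
             ¬ SameFace (suc k) (suc (suc n′)) i j
  distinct i j i≥ i≤n j≥ j≤n i≢j with +2≤⇒≡suc-suc (suc n′ ∸ k) i i≥ | +2≤⇒≡suc-suc (suc n′ ∸ k) j j≥
  ... | i′ , refl , i′≥ | j′ , refl , j′≥ =
    DistinctFacets.distinct k n′ i′ j′ k<n′ i′≥ (ℕP.≤-pred (ℕP.≤-pred i≤n)) j′≥ (ℕP.≤-pred (ℕP.≤-pred j≤n))
      (λ i′≡j′ → i≢j (cong (suc ∘ suc) i′≡j′))
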